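{- An edge-weighted graph whose underlying graph is a cycle (on at least $3$ vertices) is positive if and only if it is of one of the following three types: (a) a cycle of any length $\ge3$ with all edge weights $1$; (b) a triangle with edge weights $2,2,1$; (c) a $4$-cycle with edge weights $2,1,2,1$ in cyclic order. Furthermore, for each cycle of one of these types, an assignment of signs $\pm1$ to its edges makes it the diagram $\Gamma(A)$ of a positive quasi-Cartan matrix $A$ if and only if the product of the signs over all edges of the cycle equals $-1$.
   Context: A quasi-Cartan matrix is a square integer matrix $A$ with all diagonal entries $2$ such that $DA$ is symmetric for some diagonal $D$ with positive diagonal entries; it is positive if $DA$ is positive definite. The diagram $\Gamma(A)$ of an $n\times n$ quasi-Cartan matrix $A$ is the undirected graph on $\{1,\dots,n\}$ with an edge $\{i,j\}$ for each $i\ne j$ with $A_{ij}\neq0$, this edge carrying the weight $A_{ij}A_{ji}$ and the sign $\varepsilon_{ij}=-\operatorname{sgn}(A_{ij})=-\operatorname{sgn}(A_{ji})$. An edge-weighted graph (finite simple graph with positive integer edge weights) is positive if some assignment of signs to its edges makes it the diagram of some positive quasi-Cartan matrix.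
   Formalization: The diagonal matrix $D$ has positive rational entries, and positive definiteness of $DA$ is tested on nonzero rational vectors. -}

module Defs where

open import Data.Nat as ℕ using (ℕ; zero; suc)
open import Data.Nat.Properties using (_<?_)
open import Data.Fin using (Fin; zero; suc; toℕ; fromℕ<)
open import Data.Fin.Base using (Fin)
open import Data.Integer as ℤ using (ℤ; +_)
open import Data.Rational as ℚ using (ℚ; 0ℚ)
open import Data.Sign as Sign using (Sign)
open import Data.List using (List; foldr; map; allFin)
open import Data.Product using (Σ; ∃; _×_; _,_)
open import Data.Sum using (_⊎_)
open import Relation.Nullary using (¬_; yes; no)
open import Relation.Binary.PropositionalEquality using (_≡_; _≢_)

Σℚ : (n : ℕ) → (Fin n → ℚ) → ℚ
Σℚ n f = foldr ℚ._+_ 0ℚ (map f (allFin n))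

ι : ℤ → ℚ
ι z = z ℚ./ 1

Matrix : ℕ → Set
Matrix n = Fin n → Fin n → ℤ

DiagTwo : ∀ {n} → Matrix n → Set
DiagTwo {n} A = (i : Fin n) → A i i ≡ + 2

Symmetrizer : ∀ {n} → Matrix n → (Fin n → ℚ) → Set
Symmetrizer {n} A d =
  ((i : Fin n) → 0ℚ ℚ.< d i) ×
  ((i j : Fin n) → d i ℚ.* ι (A i j) ≡ d j ℚ.* ι (A j i))

IsQuasiCartan : ∀ {n} → Matrix n → Set
IsQuasiCartan {n} A = DiagTwo A × Σ (Fin n → ℚ) (λ d → Symmetrizer A d)

DA : ∀ {n} → Matrix n → (Fin n → ℚ) → Fin n → Fin n → ℚ
DA A d i j = d i ℚ.* ι (A i j)

PositiveDefinite : ∀ {n} → (Fin n → Fin n → ℚ) → Set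
PositiveDefinite {n} M =
  (x : Fin n → ℚ) → (∃ λ i → x i ≢ 0ℚ) →
  0ℚ ℚ.< Σℚ n (λ i → Σℚ n (λ j → x i ℚ.* M i j ℚ.* x j))

IsPositiveQuasiCartan : ∀ {n} → Matrix n → Set
IsPositiveQuasiCartan {n} A =
  DiagTwo A × Σ (Fin n → ℚ) (λ d → Symmetrizer A d × PositiveDefinite (DA A d))

-- The cycle on vertices Fin (suc m): edge k joins k and next k

next : ∀ {m} → Fin (suc m) → Fin (suc m)
next {m} i with toℕ i <? m
... | yes p = fromℕ< (ℕ.s≤s p)
... | no _  = zero

Adjacent : ∀ {m} → Fin (suc m) → Fin (suc m) → Set
Adjacent i j = (j ≡ next i) ⊎ (i ≡ next j)

-- Edge-weighted cycle with weights w (w k = weight of edge {k, next k})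
-- and signs ε (ε k = sign of edge {k, next k}).
-- Γ(A) equals this signed weighted cycle:
IsDiagramOf : ∀ {m} → Matrix (suc m) → (Fin (suc m) → ℕ) → (Fin (suc m) → Sign) → Set
IsDiagramOf {m} A w ε =
  ((i j : Fin (suc m)) → i ≢ j → (¬ (A i j ≡ + 0) → Adjacent i j) × (Adjacent i j → ¬ (A i j ≡ + 0))) ×
  ((k : Fin (suc m)) → A k (next k) ℤ.* A (next k) k ≡ + (w k)) ×
  ((k : Fin (suc m)) → (Sign.opposite (ℤ.sign (A k (next k))) ≡ ε k)
                     × (Sign.opposite (ℤ.sign (A (next k) k)) ≡ ε k))

SignedPositive : ∀ {m} → (Fin (suc m) → ℕ) → (Fin (suc m) → Sign) → Set
SignedPositive {m} w ε =
  Σ (Matrix (suc m)) λ A → IsPositiveQuasiCartan A × IsDiagramOf A w ε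

PositiveWeightedCycle : ∀ {m} → (Fin (suc m) → ℕ) → Set
PositiveWeightedCycle {m} w = Σ (Fin (suc m) → Sign) λ ε → SignedPositive w ε

signProduct : ∀ {m} → (Fin (suc m) → Sign) → Sign
signProduct {m} ε = foldr Sign._*_ Sign.+ (map ε (allFin (suc m)))

TypeA : ∀ {m} → (Fin (suc m) → ℕ) → Set
TypeA {m} w = (k : Fin (suc m)) → w k ≡ 1

TypeB : ∀ {m} → (Fin (suc m) → ℕ) → Set
TypeB {m} w = (m ≡ 2) ×
  Σ (Fin (suc m)) (λ k → (w k ≡ 1) × ((j : Fin (suc m)) → j ≢ k → w j ≡ 2))

TypeC : ∀ {m} → (Fin (suc m) → ℕ) → Set
TypeC {m} w = (m ≡ 3) ×
  Σ (Fin (suc m)) (λ k → (w k ≡ 2) × (w (next k) ≡ 1)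
                       × (w (next (next k)) ≡ 2) × (w (next (next (next k))) ≡ 1))

OfListedType : ∀ {m} → (Fin (suc m) → ℕ) → Set
OfListedType w = TypeA w ⊎ TypeB w ⊎ TypeC w

{-# OPTIONS --safe #-}
module Submission where

-- Write α i, β i for |A i (next i)|, |A (next i) i| and ε i for the sign of edge i.  With a
-- symmetrizer d, half of xᵀ(DA)x is ∑ᵢ (d i x i² - ε i d i α i x i x (next i)), and
-- d i α i = d (next i) β i.  Changing the signs of some vertices changes the edge signs but not
-- their product, so positivity depends only on that product; the product + is excluded by the
-- all-ones vector, and a product - can be moved onto the first edge.  Multiplying the relations
-- around the cycle gives ∏ α = ∏ β.  Test vectors on short paths bound the weights (each at most 3,
-- adjacent ones summing to at most 3) and exclude two affine configurations; with ∏ α = ∏ β only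
-- the listed triangles and squares survive, and on longer cycles an edge with α = 2 is excluded by
-- deleting a vertex next to a minimum of d.  Conversely each listed cycle has an explicit d whose
-- form is a sum of squares vanishing only at 0.

open import Level using (0ℓ)
open import Algebra.Bundles using (CommutativeRing)
open import Data.Empty using (⊥; ⊥-elim)
open import Data.Nat as ℕ using (ℕ; zero; suc; z≤n; s≤s)
import Data.Nat.Properties as ℕP
open import Data.Fin as F using (Fin; zero; suc; toℕ; inject₁; fromℕ; fromℕ<; punchIn; punchOut)
import Data.Fin.Properties as FP
open import Data.Fin.Induction using (<-weakInduction)
open import Data.Fin.Permutation as Perm using (Permutation′; _⟨$⟩ʳ_; _⟨$⟩ˡ_; _∘ₚ_)
open import Data.Integer as ℤ using (ℤ; _◃_; ∣_∣; sign)
import Data.Integer.Properties as ℤP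
open import Data.Rational as ℚ using (ℚ; 0ℚ; 1ℚ; _+_; _*_; _-_; -_; _≤_; _<_)
import Data.Rational.Properties as ℚP
open import Data.Rational.Unnormalised as ℚᵘ using (mkℚᵘ; *≤*)
import Data.Rational.Unnormalised.Properties as ℚᵘP
open import Data.Sign as Sign using (Sign)
import Data.Sign.Properties as SignP
open import Data.List as List using (List; []; _∷_; allFin; tabulate)
open import Data.List.Membership.Propositional using (_∈_)
open import Data.List.Relation.Unary.Any using (here; there)
import Data.List.Relation.Unary.All as All
import Data.Vec as Vec
open import Data.List.Membership.Propositional.Properties using (∈-allFin)
open import Relation.Binary.Bundles using (DecTotalOrder)
open import Data.List.Extrema (DecTotalOrder.totalOrder ℚP.≤-decTotalOrder) using (argmin; f[argmin]≤f[xs])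
import Data.List.Properties as ListP
import Data.Vec.Functional as Vector
open import Data.Product using (Σ; ∃; _×_; _,_; proj₁; proj₂)
open import Data.Sum using (_⊎_; inj₁; inj₂)
open import Function using (_∘_; id)
open import Function.Bundles using (_⇔_; mk⇔)
open import Relation.Binary.PropositionalEquality
open import Relation.Nullary using (¬_; Dec; yes; no; contradiction)
open import Relation.Binary.Definitions using (tri<; tri≈; tri>)
open import Relation.Nullary.Decidable using (dec⇒maybe; ¬?; _×-dec_; _⊎-dec_; _→-dec_; from-yes)
open import Tactic.RingSolver using (solve-∀)
import Tactic.RingSolver.Core.AlmostCommutativeRing as ACR
open import Defs

open import Algebra.Properties.Semiring.Sum (CommutativeRing.semiring ℚP.+-*-commutativeRing)
  using (sum; sum-cong-≗; sum-remove; sum-permute; sum-replicate-zero; ∑-distrib-+; ∑-comm; *-distribˡ-sum)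
open import Algebra.Properties.CommutativeMonoid.Sum ℚP.*-1-commutativeMonoid
  using () renaming (sum to ∏ℚ; sum-cong-≗ to ∏ℚ-cong-≗; ∑-distrib-+ to ∏ℚ-distrib-*; sum-permute to ∏ℚ-permute)
open import Algebra.Properties.CommutativeMonoid.Sum ℕP.*-1-commutativeMonoid
  using () renaming (sum to ∏ℕ; sum-cong-≗ to ∏ℕ-cong-≗; sum-replicate-zero to ∏ℕ-replicate-one)
open import Algebra.Properties.CommutativeMonoid.Sum SignP.*-commutativeMonoid
  using () renaming (sum to ∏±; ∑-distrib-+ to ∏±-distrib-*; sum-permute to ∏±-permute; sum-replicate-zero to ∏±-replicate-one)

ℚ-ring : ACR.AlmostCommutativeRing 0ℓ 0ℓ
ℚ-ring = ACR.fromCommutativeRing ℚP.+-*-commutativeRing (λ x → dec⇒maybe (0ℚ ℚP.≟ x))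

⟦_⟧ : ℕ → ℚ
⟦ n ⟧ = ι (ℤ.+ n)

private
  toℚᵘ-ι : ∀ z → ℚ.toℚᵘ (ι z) ℚᵘ.≃ mkℚᵘ z 0
  toℚᵘ-ι z = ℚP.toℚᵘ-fromℚᵘ (mkℚᵘ z 0)

ι-homo-* : ∀ a b → ι (a ℤ.* b) ≡ ι a * ι b
ι-homo-* a b = ℚP.toℚᵘ-injective (ℚᵘP.≃-trans (toℚᵘ-ι (a ℤ.* b))
  (ℚᵘP.≃-sym (ℚᵘP.≃-trans (ℚP.toℚᵘ-homo-* (ι a) (ι b)) (ℚᵘP.*-cong (toℚᵘ-ι a) (toℚᵘ-ι b)))))

ι-homo-+ : ∀ a b → ι (a ℤ.+ b) ≡ ι a + ι b
ι-homo-+ a b = ℚP.toℚᵘ-injective (ℚᵘP.≃-trans (toℚᵘ-ι (a ℤ.+ b))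
  (ℚᵘP.≃-sym (ℚᵘP.≃-trans (ℚP.toℚᵘ-homo-+ (ι a) (ι b))
    (ℚᵘP.≃-trans (ℚᵘP.+-cong (toℚᵘ-ι a) (toℚᵘ-ι b))
      (ℚᵘP.≃-reflexive (cong (λ z → mkℚᵘ z 0) (cong₂ ℤ._+_ (ℤP.*-identityʳ a) (ℤP.*-identityʳ b))))))))

ι-homo‿- : ∀ a → ι (ℤ.- a) ≡ - ι a
ι-homo‿- a = ℚP.toℚᵘ-injective (ℚᵘP.≃-trans (toℚᵘ-ι (ℤ.- a))
  (ℚᵘP.≃-sym (ℚᵘP.≃-trans (ℚP.toℚᵘ-homo‿- (ι a)) (ℚᵘP.-‿cong (toℚᵘ-ι a)))))

ι-cancel-≤ : ∀ {a b} → ι a ≤ ι b → a ℤ.≤ b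
ι-cancel-≤ {a} {b} p with ℚᵘP.≤-respʳ-≃ (toℚᵘ-ι b) (ℚᵘP.≤-respˡ-≃ (toℚᵘ-ι a) (ℚP.toℚᵘ-mono-≤ p))
... | *≤* r = subst₂ ℤ._≤_ (ℤP.*-identityʳ a) (ℤP.*-identityʳ b) r

ι-mono-≤ : ∀ {a b} → a ℤ.≤ b → ι a ≤ ι b
ι-mono-≤ {a} {b} p = ℚP.toℚᵘ-cancel-≤ (ℚᵘP.≤-respʳ-≃ (ℚᵘP.≃-sym (toℚᵘ-ι b))
  (ℚᵘP.≤-respˡ-≃ (ℚᵘP.≃-sym (toℚᵘ-ι a)) (*≤* (subst₂ ℤ._≤_ (sym (ℤP.*-identityʳ a)) (sym (ℤP.*-identityʳ b)) p))))

⟦⟧-homo-* : ∀ a b → ⟦ a ℕ.* b ⟧ ≡ ⟦ a ⟧ * ⟦ b ⟧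
⟦⟧-homo-* a b = trans (cong ι (ℤP.pos-* a b)) (ι-homo-* (ℤ.+ a) (ℤ.+ b))

⟦⟧-homo-+ : ∀ a b → ⟦ a ℕ.+ b ⟧ ≡ ⟦ a ⟧ + ⟦ b ⟧
⟦⟧-homo-+ a b = ι-homo-+ (ℤ.+ a) (ℤ.+ b)

⟦⟧-mono-≤ : ∀ {a b} → a ℕ.≤ b → ⟦ a ⟧ ≤ ⟦ b ⟧
⟦⟧-mono-≤ p = ι-mono-≤ (ℤ.+≤+ p)

⟦⟧-cancel-≤ : ∀ {a b} → ⟦ a ⟧ ≤ ⟦ b ⟧ → a ℕ.≤ b
⟦⟧-cancel-≤ {a} {b} p with ι-cancel-≤ {ℤ.+ a} {ℤ.+ b} p
... | ℤ.+≤+ r = r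

⟦⟧-cancel-< : ∀ {a b} → ⟦ a ⟧ < ⟦ b ⟧ → a ℕ.< b
⟦⟧-cancel-< {a} {b} p = ℕP.≰⇒> (λ b≤a → ℚP.<-irrefl refl (ℚP.<-≤-trans p (⟦⟧-mono-≤ b≤a)))

⟦⟧-injective : ∀ {a b} → ⟦ a ⟧ ≡ ⟦ b ⟧ → a ≡ b
⟦⟧-injective e = ℕP.≤-antisym (⟦⟧-cancel-≤ (ℚP.≤-reflexive e)) (⟦⟧-cancel-≤ (ℚP.≤-reflexive (sym e)))

⟦⟧-pos : ∀ {a} → 1 ℕ.≤ a → 0ℚ < ⟦ a ⟧
⟦⟧-pos p = ℚP.<-≤-trans (ℚP.positive⁻¹ 1ℚ) (⟦⟧-mono-≤ p)

<⇒≱ : ∀ {p q} → p < q → ¬ q ≤ p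
<⇒≱ p<q q≤p = ℚP.<-irrefl refl (ℚP.<-≤-trans p<q q≤p)

≤⇒-≤0 : ∀ {p q} → p ≤ q → p - q ≤ 0ℚ
≤⇒-≤0 {p} {q} p≤q = subst (p - q ≤_) (ℚP.+-inverseʳ q) (ℚP.+-monoˡ-≤ (- q) p≤q)

0<-⇒< : ∀ {p q} → 0ℚ < p - q → q < p
0<-⇒< {p} {q} 0<p-q = subst₂ _<_ (ℚP.+-identityˡ q) (shift p q) (ℚP.+-monoˡ-< q 0<p-q)
  where
  shift : ∀ p q → p - q + q ≡ p
  shift = solve-∀ ℚ-ring

*-pos : ∀ {p q} → 0ℚ < p → 0ℚ < q → 0ℚ < p * q
*-pos {p} {q} 0<p 0<q = ℚP.positive⁻¹ (p * q) {{ℚP.pos*pos⇒pos p {{ℚ.positive 0<p}} q {{ℚ.positive 0<q}}}}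

*-cancelˡ-pos : ∀ {p q} → 0ℚ < p → 0ℚ < p * q → 0ℚ < q
*-cancelˡ-pos {p} {q} 0<p 0<pq =
  ℚP.*-cancelˡ-<-nonNeg p {{ℚ.nonNegative (ℚP.<⇒≤ 0<p)}} (subst (_< p * q) (sym (ℚP.*-zeroʳ p)) 0<pq)

≤-*⟦⟧ : ∀ {p} a → 0ℚ < p → 1 ℕ.≤ a → p ≤ p * ⟦ a ⟧
≤-*⟦⟧ {p} a 0<p 1≤a = subst (_≤ p * ⟦ a ⟧) (ℚP.*-identityʳ p)
  (ℚP.*-monoˡ-≤-nonNeg p {{ℚ.nonNegative (ℚP.<⇒≤ 0<p)}} (⟦⟧-mono-≤ 1≤a))

square-nonneg : ∀ x → 0ℚ ≤ x * x
square-nonneg x with ℚP.<-cmp x 0ℚ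
... | tri< x<0 _ _ = ℚP.<⇒≤ (ℚP.positive⁻¹ (x * x) {{ℚP.neg*neg⇒pos x {{ℚ.negative x<0}} x {{ℚ.negative x<0}}}})
... | tri≈ _ refl _ = ℚP.≤-refl
... | tri> _ _ 0<x = ℚP.<⇒≤ (*-pos 0<x 0<x)

square-pos : ∀ {x} → x ≢ 0ℚ → 0ℚ < x * x
square-pos {x} x≢0 with ℚP.<-cmp x 0ℚ
... | tri< x<0 _ _ = ℚP.positive⁻¹ (x * x) {{ℚP.neg*neg⇒pos x {{ℚ.negative x<0}} x {{ℚ.negative x<0}}}}
... | tri≈ _ x≡0 _ = contradiction x≡0 x≢0
... | tri> _ _ 0<x = *-pos 0<x 0<x

foldr-map-allFin : ∀ {A : Set} (_∙_ : A → A → A) (e : A) {n} (f : Fin n → A) →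
                   List.foldr _∙_ e (List.map f (allFin n)) ≡ Vector.foldr _∙_ e f
foldr-map-allFin _∙_ e {n} f = trans (cong (List.foldr _∙_ e) (ListP.map-tabulate id f)) (go n f)
  where
  go : ∀ n (f : Fin n → _) → List.foldr _∙_ e (tabulate f) ≡ Vector.foldr _∙_ e f
  go zero    f = refl
  go (suc n) f = cong (f zero ∙_) (go n (f ∘ suc))

Σℚ≡sum : ∀ n (f : Fin n → ℚ) → Σℚ n f ≡ sum f
Σℚ≡sum n = foldr-map-allFin _+_ 0ℚ

signProduct≡∏± : ∀ {m} (ε : Fin (suc m) → Sign) → signProduct ε ≡ ∏± ε
signProduct≡∏± = foldr-map-allFin Sign._*_ Sign.+

sum-zero : ∀ {n} {f : Fin n → ℚ} → (∀ i → f i ≡ 0ℚ) → sum f ≡ 0ℚ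
sum-zero {n} f≡0 = trans (sum-cong-≗ f≡0) (sum-replicate-zero n)

sum-mono-≤ : ∀ {n} {f g : Fin n → ℚ} → (∀ i → f i ≤ g i) → sum f ≤ sum g
sum-mono-≤ {zero}  f≤g = ℚP.≤-refl
sum-mono-≤ {suc n} f≤g = ℚP.+-mono-≤ (f≤g zero) (sum-mono-≤ (f≤g ∘ suc))

sum-nonpos : ∀ {n} {f : Fin n → ℚ} → (∀ i → f i ≤ 0ℚ) → sum f ≤ 0ℚ
sum-nonpos {n} f≤0 = ℚP.≤-trans (sum-mono-≤ f≤0) (ℚP.≤-reflexive (sum-replicate-zero n))

sum-nonneg : ∀ {n} {f : Fin n → ℚ} → (∀ i → 0ℚ ≤ f i) → 0ℚ ≤ sum f
sum-nonneg {n} 0≤f = ℚP.≤-trans (ℚP.≤-reflexive (sym (sum-replicate-zero n))) (sum-mono-≤ 0≤f)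

sum-single : ∀ {n} {f : Fin (suc n) → ℚ} a → (∀ j → j ≢ a → f j ≡ 0ℚ) → sum f ≡ f a
sum-single {f = f} a f≡0 = begin
  sum f                       ≡⟨ sum-remove {i = a} f ⟩
  f a + sum (f ∘ punchIn a)  ≡⟨ cong (f a +_) (sum-zero (λ j → f≡0 _ (FP.punchInᵢ≢i a j))) ⟩
  f a + 0ℚ                    ≡⟨ ℚP.+-identityʳ (f a) ⟩
  f a                         ∎
  where open ≡-Reasoning

sum-≥-term : ∀ {n} {f : Fin (suc n) → ℚ} → (∀ i → 0ℚ ≤ f i) → ∀ a → f a ≤ sum f
sum-≥-term {f = f} 0≤f a = begin
  f a                        ≡⟨ ℚP.+-identityʳ (f a) ⟨
  f a + 0ℚ                   ≤⟨ ℚP.+-monoʳ-≤ (f a) (sum-nonneg (0≤f ∘ punchIn a)) ⟩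
  f a + sum (f ∘ punchIn a)  ≡⟨ sum-remove {i = a} f ⟨
  sum f                      ∎
  where open ℚP.≤-Reasoning

sum-≤-two-terms : ∀ {n} {f : Fin (suc n) → ℚ} {a b} → a ≢ b →
                  (∀ i → i ≢ a → i ≢ b → f i ≤ 0ℚ) → sum f ≤ f a + f b
sum-≤-two-terms {n = suc n} {f} {a} {b} a≢b f≤0 = begin
  sum f                              ≡⟨ sum-remove {i = a} f ⟩
  f a + sum g                        ≡⟨ cong (f a +_) (sum-remove {i = b′} g) ⟩
  f a + (g b′ + sum (g ∘ punchIn b′)) ≤⟨ ℚP.+-monoʳ-≤ (f a) (ℚP.+-monoʳ-≤ (g b′) (sum-nonpos rest≤0)) ⟩
  f a + (g b′ + 0ℚ)                  ≡⟨ cong (λ x → f a + x) (trans (ℚP.+-identityʳ (g b′)) (cong f (FP.punchIn-punchOut a≢b))) ⟩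
  f a + f b                          ∎
  where
  open ℚP.≤-Reasoning
  g = f ∘ punchIn a
  b′ = punchOut a≢b
  rest≤0 : ∀ j → g (punchIn b′ j) ≤ 0ℚ
  rest≤0 j = f≤0 _ (FP.punchInᵢ≢i a (punchIn b′ j))
    (λ eq → FP.punchInᵢ≢i b′ j (FP.punchIn-injective a _ _ (trans eq (sym (FP.punchIn-punchOut a≢b)))))
sum-≤-two-terms {n = zero} {a = zero} {zero} a≢b _ = contradiction refl a≢b

module _ {m : ℕ} where

  next-inject₁ : (j : Fin m) → next (inject₁ j) ≡ suc j
  next-inject₁ j with toℕ (inject₁ j) ℕP.<? m
  ... | yes p = FP.toℕ-injective (trans (FP.toℕ-fromℕ< (s≤s p)) (cong suc (FP.toℕ-inject₁ j)))
  ... | no ¬p = contradiction (subst (ℕ._< m) (sym (FP.toℕ-inject₁ j)) (FP.toℕ<n j)) ¬p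

  next-fromℕ : next (fromℕ m) ≡ zero
  next-fromℕ with toℕ (fromℕ m) ℕP.<? m
  ... | yes p = contradiction (subst (ℕ._< m) (FP.toℕ-fromℕ m) p) (ℕP.<-irrefl refl)
  ... | no _  = refl

  prev : Fin (suc m) → Fin (suc m)
  prev zero    = fromℕ m
  prev (suc j) = inject₁ j

  next-prev : ∀ i → next (prev i) ≡ i
  next-prev zero    = next-fromℕ
  next-prev (suc j) = next-inject₁ j

  prev-next : ∀ i → prev (next i) ≡ i
  prev-next i with toℕ i ℕP.<? m
  ... | yes p = FP.toℕ-injective (trans (FP.toℕ-inject₁ (fromℕ< p)) (FP.toℕ-fromℕ< p))
  ... | no ¬p = FP.toℕ-injective (trans (FP.toℕ-fromℕ m) (sym (ℕP.≤-antisym (ℕP.≤-pred (FP.toℕ<n i)) (ℕP.≮⇒≥ ¬p))))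

  next-injective : ∀ {i j} → next i ≡ next j → i ≡ j
  next-injective {i} {j} eq = trans (sym (prev-next i)) (trans (cong prev eq) (prev-next j))

  fromℕ-or-inject₁ : ∀ i → i ≡ fromℕ m ⊎ ∃ λ j → i ≡ inject₁ j
  fromℕ-or-inject₁ i with next i | prev-next i
  ... | zero  | eq = inj₁ (sym eq)
  ... | suc j | eq = inj₂ (j , sym eq)

  toℕ-next : ∀ i → toℕ (next i) ≡ suc (toℕ i) ⊎ (toℕ i ≡ m × next i ≡ zero)
  toℕ-next i with fromℕ-or-inject₁ i
  ... | inj₁ refl       = inj₂ (FP.toℕ-fromℕ m , next-fromℕ)
  ... | inj₂ (j , refl) = inj₁ (trans (cong toℕ (next-inject₁ j)) (cong suc (sym (FP.toℕ-inject₁ j))))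

  next≡zero⇒fromℕ : ∀ {i} → next i ≡ zero → i ≡ fromℕ m
  next≡zero⇒fromℕ {i} eq = trans (sym (prev-next i)) (cong prev eq)

  cycle-induction : (P : Fin (suc m) → Set) → P zero → (∀ i → P i → P (next i)) → ∀ i → P i
  cycle-induction P P₀ step = <-weakInduction P P₀ (λ j → subst P (next-inject₁ j) ∘ step (inject₁ j))

  nextPerm : Permutation′ (suc m)
  nextPerm = Perm.permutation next prev next-prev prev-next

next≢id : ∀ {m} → 1 ℕ.≤ m → (i : Fin (suc m)) → next i ≢ i
next≢id 1≤m i eq with toℕ-next i
... | inj₁ t       = ℕP.<⇒≢ (ℕP.n<1+n (toℕ i)) (trans (cong toℕ (sym eq)) t)
... | inj₂ (t , z) = ℕP.<⇒≢ 1≤m (trans (sym (cong toℕ (trans (sym eq) z))) t)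

next²≢id : ∀ {m} → 2 ℕ.≤ m → (i : Fin (suc m)) → next (next i) ≢ i
next²≢id {m} 2≤m i eq with toℕ-next i | toℕ-next (next i)
... | inj₁ t       | inj₁ t′       = ℕP.<⇒≢ (ℕP.≤-trans (ℕP.n<1+n (toℕ i)) (ℕP.n≤1+n _))
  (trans (cong toℕ (sym eq)) (trans t′ (cong suc t)))
... | inj₁ t       | inj₂ (t′ , z) = ℕP.<⇒≢ 2≤m
  (trans (sym (cong (suc ∘ toℕ) (trans (sym eq) z))) (trans (sym t) t′))
... | inj₂ (t , z) | inj₁ t′       = ℕP.<⇒≢ 2≤m
  (trans (cong (suc ∘ toℕ) (sym z)) (trans (sym t′) (trans (cong toℕ eq) t)))
... | inj₂ (t , z) | inj₂ (t′ , _) = ℕP.<⇒≢ (ℕP.≤-trans (s≤s z≤n) 2≤m) (trans (cong toℕ (sym z)) t′)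

record Rotation (m : ℕ) : Set where
  field
    perm      : Permutation′ (suc m)
    perm-next : ∀ i → perm ⟨$⟩ʳ next i ≡ next (perm ⟨$⟩ʳ i)

  rot unrot : Fin (suc m) → Fin (suc m)
  rot   = perm ⟨$⟩ʳ_
  unrot = perm ⟨$⟩ˡ_

  unrot-rot : ∀ i → unrot (rot i) ≡ i
  unrot-rot i = Perm.inverseˡ perm

  rot-unrot : ∀ i → rot (unrot i) ≡ i
  rot-unrot i = Perm.inverseʳ perm

  rot-injective : ∀ {i j} → rot i ≡ rot j → i ≡ j
  rot-injective {i} {j} eq = trans (sym (unrot-rot i)) (trans (cong unrot eq) (unrot-rot j))

  unrot-next : ∀ i → unrot (next i) ≡ next (unrot i)
  unrot-next i = rot-injective (trans (rot-unrot (next i)) (sym (trans (perm-next (unrot i)) (cong next (rot-unrot i)))))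

  rot-prev : ∀ i → rot (prev i) ≡ prev (rot i)
  rot-prev i = next-injective (trans (sym (perm-next (prev i))) (trans (cong rot (next-prev i)) (sym (next-prev (rot i)))))

  inverse : Rotation m
  inverse = record { perm = Perm.flip perm ; perm-next = unrot-next }

open Rotation using (rot; unrot)

module _ {m : ℕ} where

  private
    power : ℕ → Permutation′ (suc m)
    power zero    = Perm.id
    power (suc r) = power r ∘ₚ nextPerm

    power-next : ∀ r i → power r ⟨$⟩ʳ next i ≡ next (power r ⟨$⟩ʳ i)
    power-next zero    i = refl
    power-next (suc r) i = cong next (power-next r i)

    power-zero : ∀ k → power (toℕ k) ⟨$⟩ʳ zero ≡ k
    power-zero = <-weakInduction (λ k → power (toℕ k) ⟨$⟩ʳ zero ≡ k) refl
      (λ j eq → trans (cong (λ r → next (power r ⟨$⟩ʳ zero)) (sym (FP.toℕ-inject₁ j)))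
                      (trans (cong next eq) (next-inject₁ j)))

  rotationTo : Fin (suc m) → Rotation m
  rotationTo k = record { perm = power (toℕ k) ; perm-next = power-next (toℕ k) }

  rotationTo-zero : ∀ k → rot (rotationTo k) zero ≡ k
  rotationTo-zero = power-zero

  rotationTo-one : ∀ k → rot (rotationTo (prev k)) (next zero) ≡ k
  rotationTo-one k = trans (Rotation.perm-next (rotationTo (prev k)) zero) (trans (cong next (rotationTo-zero (prev k))) (next-prev k))

σ : Sign → ℚ
σ Sign.+ = 1ℚ
σ Sign.- = - 1ℚ

σ-homo-* : ∀ s t → σ (s Sign.* t) ≡ σ s * σ t
σ-homo-* Sign.+ Sign.+ = refl
σ-homo-* Sign.+ Sign.- = refl
σ-homo-* Sign.- Sign.+ = refl
σ-homo-* Sign.- Sign.- = refl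

σ-square : ∀ s → σ s * σ s ≡ 1ℚ
σ-square Sign.+ = refl
σ-square Sign.- = refl

σ-opposite : ∀ s → σ (Sign.opposite s) ≡ - σ s
σ-opposite Sign.+ = refl
σ-opposite Sign.- = refl

ι-◃ : ∀ s n → ι (s ◃ n) ≡ σ s * ⟦ n ⟧
ι-◃ Sign.+ n = trans (cong ι (ℤP.+◃n≡+n n)) (sym (ℚP.*-identityˡ ⟦ n ⟧))
ι-◃ Sign.- n = trans (cong ι (ℤP.-◃n≡-n n)) (trans (ι-homo‿- (ℤ.+ n)) (neg≡-1* ⟦ n ⟧))
  where
  neg≡-1* : ∀ x → - x ≡ - 1ℚ * x
  neg≡-1* = solve-∀ ℚ-ring

σ-cancel : ∀ s {x y} → σ s * x ≡ σ s * y → x ≡ y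
σ-cancel s {x} {y} eq = begin
  x                ≡⟨ unfold x ⟩
  σ s * (σ s * x)  ≡⟨ cong (σ s *_) eq ⟩
  σ s * (σ s * y)  ≡⟨ unfold y ⟨
  y                ∎
  where
  open ≡-Reasoning
  unfold : ∀ z → z ≡ σ s * (σ s * z)
  unfold z = trans (sym (ℚP.*-identityˡ z)) (trans (cong (_* z) (sym (σ-square s))) (ℚP.*-assoc (σ s) (σ s) z))

firstNegative : ∀ {m} → Fin (suc m) → Sign
firstNegative zero    = Sign.-
firstNegative (suc _) = Sign.+

∏±-firstNegative : ∀ {m} → ∏± (firstNegative {m}) ≡ Sign.-
∏±-firstNegative {m} = cong (Sign.- Sign.*_) (∏±-replicate-one m)

module _ {m : ℕ} where

  private
    prefix : ∀ {k} → (Fin (suc k) → Sign) → Fin (suc k) → Sign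
    prefix h zero = Sign.+
    prefix {suc k} h (suc i) = h zero Sign.* prefix (h ∘ suc) i

    prefix-step : ∀ {k} (h : Fin (suc k) → Sign) (j : Fin k) → prefix h (suc j) ≡ prefix h (inject₁ j) Sign.* h (inject₁ j)
    prefix-step {suc k} h zero    = SignP.*-identityʳ (h zero)
    prefix-step {suc k} h (suc j) = trans (cong (h zero Sign.*_) (prefix-step (h ∘ suc) j))
                                          (sym (SignP.*-assoc (h zero) _ _))

    prefix-last : ∀ {k} (h : Fin (suc k) → Sign) → ∏± h ≡ prefix h (fromℕ k) Sign.* h (fromℕ k)
    prefix-last {zero}  h = SignP.*-identityʳ (h zero)
    prefix-last {suc k} h = trans (cong (h zero Sign.*_) (prefix-last (h ∘ suc))) (sym (SignP.*-assoc (h zero) _ _))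

    cancel-twice : ∀ e p g → e Sign.* p Sign.* (p Sign.* (e Sign.* g)) ≡ g
    cancel-twice e p g = begin
      e Sign.* p Sign.* (p Sign.* (e Sign.* g))  ≡⟨ SignP.*-assoc e p _ ⟩
      e Sign.* (p Sign.* (p Sign.* (e Sign.* g))) ≡⟨ cong (e Sign.*_) (SignP.*-assoc p p _) ⟨
      e Sign.* (p Sign.* p Sign.* (e Sign.* g))   ≡⟨ cong (λ s → e Sign.* (s Sign.* (e Sign.* g))) (SignP.s*s≡+ p) ⟩
      e Sign.* (e Sign.* g)                       ≡⟨ SignP.*-assoc e e g ⟨
      e Sign.* e Sign.* g                         ≡⟨ cong (Sign._* g) (SignP.s*s≡+ e) ⟩
      g                                           ∎
      where open ≡-Reasoning

    close-cycle : ∀ e p g → p Sign.* (e Sign.* g) ≡ Sign.+ → e Sign.* p Sign.* Sign.+ ≡ g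
    close-cycle Sign.+ Sign.+ Sign.+ _ = refl
    close-cycle Sign.+ Sign.- Sign.- _ = refl
    close-cycle Sign.- Sign.+ Sign.- _ = refl
    close-cycle Sign.- Sign.- Sign.+ _ = refl

  gauge : (ε g : Fin (suc m) → Sign) → ∏± ε ≡ ∏± g →
          ∃ λ t → ∀ i → ε i Sign.* t i Sign.* t (next i) ≡ g i
  -- Switch vertex i by the product of ε g over the edges before it; the last edge closes up
  -- because ∏ ε ≡ ∏ g.
  gauge ε g ∏ε≡∏g = prefix h , switch
    where
    h : Fin (suc m) → Sign
    h i = ε i Sign.* g i
    ∏h≡+ : ∏± h ≡ Sign.+
    ∏h≡+ = trans (∏±-distrib-* ε g) (trans (cong (Sign._* ∏± g) ∏ε≡∏g) (SignP.s*s≡+ (∏± g)))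
    switch : ∀ i → ε i Sign.* prefix h i Sign.* prefix h (next i) ≡ g i
    switch i with fromℕ-or-inject₁ i
    ... | inj₂ (j , refl) = begin
      ε (inject₁ j) Sign.* prefix h (inject₁ j) Sign.* prefix h (next (inject₁ j))
        ≡⟨ cong (λ k → ε (inject₁ j) Sign.* prefix h (inject₁ j) Sign.* prefix h k) (next-inject₁ j) ⟩
      ε (inject₁ j) Sign.* prefix h (inject₁ j) Sign.* prefix h (suc j)
        ≡⟨ cong (ε (inject₁ j) Sign.* prefix h (inject₁ j) Sign.*_) (prefix-step h j) ⟩
      ε (inject₁ j) Sign.* prefix h (inject₁ j) Sign.* (prefix h (inject₁ j) Sign.* h (inject₁ j))
        ≡⟨ cancel-twice (ε (inject₁ j)) (prefix h (inject₁ j)) (g (inject₁ j)) ⟩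
      g (inject₁ j) ∎
      where open ≡-Reasoning
    ... | inj₁ refl = trans (cong (λ k → ε (fromℕ m) Sign.* prefix h (fromℕ m) Sign.* prefix h k) next-fromℕ)
                            (close-cycle (ε (fromℕ m)) (prefix h (fromℕ m)) (g (fromℕ m)) (trans (sym (prefix-last h)) ∏h≡+))

-- The quadratic form of a cycle

Nonzero : ∀ {n} → (Fin n → ℚ) → Set
Nonzero μ = ∃ λ i → μ i ≢ 0ℚ

-- d is a symmetrizer and α i, β i are the absolute values of the entries A i (next i),
-- A (next i) i of a quasi-Cartan matrix A whose diagram is the cycle; with edge signs g,
-- form g μ is half of μᵀ (DA) μ.
record CycleData (m : ℕ) : Set where
  field
    d        : Fin (suc m) → ℚ
    α β      : Fin (suc m) → ℕ
    d-pos    : ∀ i → 0ℚ < d i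
    α-pos    : ∀ i → 1 ℕ.≤ α i
    β-pos    : ∀ i → 1 ℕ.≤ β i
    balanced : ∀ i → d i * ⟦ α i ⟧ ≡ d (next i) * ⟦ β i ⟧

  weight : Fin (suc m) → ℕ
  weight i = α i ℕ.* β i

  c : Fin (suc m) → ℚ
  c i = d i * ⟦ α i ⟧

  edgeTerm : (Fin (suc m) → Sign) → (Fin (suc m) → ℚ) → Fin (suc m) → ℚ
  edgeTerm g μ i = d i * (μ i * μ i) - σ (g i) * c i * (μ i * μ (next i))

  form : (Fin (suc m) → Sign) → (Fin (suc m) → ℚ) → ℚ
  form g μ = sum (edgeTerm g μ)

  Positive : (Fin (suc m) → Sign) → Set
  Positive g = ∀ μ → Nonzero μ → 0ℚ < form g μ

  form-cong : ∀ {g g′} → (∀ i → g i ≡ g′ i) → ∀ μ → form g μ ≡ form g′ μ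
  form-cong g≗g′ μ = sum-cong-≗ (λ i → cong (λ s → d i * (μ i * μ i) - σ s * c i * (μ i * μ (next i))) (g≗g′ i))

  _⊙_ : (Fin (suc m) → Sign) → (Fin (suc m) → ℚ) → Fin (suc m) → ℚ
  (t ⊙ μ) i = σ (t i) * μ i

  form-switch : ∀ g t μ → form g (t ⊙ μ) ≡ form (λ i → g i Sign.* t i Sign.* t (next i)) μ
  form-switch g t μ = sum-cong-≗ term
    where
    expand : ∀ D C s u v x y → D * ((u * x) * (u * x)) - s * C * ((u * x) * (v * y))
                             ≡ D * (x * x) * (u * u) - s * u * v * C * (x * y)
    expand = solve-∀ ℚ-ring
    term : ∀ i → edgeTerm g (t ⊙ μ) i ≡ edgeTerm (λ j → g j Sign.* t j Sign.* t (next j)) μ i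
    term i = begin
      edgeTerm g (t ⊙ μ) i
        ≡⟨ expand (d i) (c i) (σ (g i)) (σ (t i)) (σ (t (next i))) (μ i) (μ (next i)) ⟩
      d i * (μ i * μ i) * (σ (t i) * σ (t i)) - σ (g i) * σ (t i) * σ (t (next i)) * c i * (μ i * μ (next i))
        ≡⟨ cong₂ (λ a b → d i * (μ i * μ i) * a - b * c i * (μ i * μ (next i)))
                 (σ-square (t i)) (sym (trans (σ-homo-* (g i Sign.* t i) (t (next i))) (cong (_* σ (t (next i))) (σ-homo-* (g i) (t i))))) ⟩
      d i * (μ i * μ i) * 1ℚ - σ (g i Sign.* t i Sign.* t (next i)) * c i * (μ i * μ (next i))
        ≡⟨ cong (λ a → a - σ (g i Sign.* t i Sign.* t (next i)) * c i * (μ i * μ (next i))) (ℚP.*-identityʳ (d i * (μ i * μ i))) ⟩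
      edgeTerm (λ j → g j Sign.* t j Sign.* t (next j)) μ i ∎
      where open ≡-Reasoning

  ⊙-nonzero : ∀ t {μ} → Nonzero μ → Nonzero (t ⊙ μ)
  ⊙-nonzero t (k , μk≢0) = k , λ eq → μk≢0 (σ-cancel (t k) (trans eq (sym (ℚP.*-zeroʳ (σ (t k))))))

  Positive-gauge : ∀ ε g → ∏± ε ≡ ∏± g → Positive ε → Positive g
  Positive-gauge ε g ∏ε≡∏g pos μ μ≢0 with gauge ε g ∏ε≡∏g
  ... | t , switch = subst (0ℚ <_) (trans (form-switch ε t μ) (form-cong switch μ)) (pos (t ⊙ μ) (⊙-nonzero t μ≢0))

  Positive⇒∏±≡- : ∀ g → Positive g → ∏± g ≡ Sign.-
  Positive⇒∏±≡- g pos with ∏± g in ∏g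
  ... | Sign.- = refl
  ... | Sign.+ = contradiction (sum-nonpos term≤0) (<⇒≱ (all-plus (λ _ → 1ℚ) (zero , λ ())))
    where
    all-plus : Positive (λ _ → Sign.+)
    all-plus = Positive-gauge g (λ _ → Sign.+) (trans ∏g (sym (∏±-replicate-one (suc m)))) pos
    term≤0 : ∀ i → edgeTerm (λ _ → Sign.+) (λ _ → 1ℚ) i ≤ 0ℚ
    term≤0 i = subst (_≤ 0ℚ) (sym (unit-term (d i) (c i))) (≤⇒-≤0 (≤-*⟦⟧ (α i) (d-pos i) (α-pos i)))
      where
      unit-term : ∀ D C → D * (1ℚ * 1ℚ) - 1ℚ * C * (1ℚ * 1ℚ) ≡ D - C
      unit-term = solve-∀ ℚ-ring

module _ {m : ℕ} (ρ : Rotation m) (D : CycleData m) where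
  open CycleData D

  rotateData : CycleData m
  rotateData = record
    { d        = d ∘ rot ρ
    ; α        = α ∘ rot ρ
    ; β        = β ∘ rot ρ
    ; d-pos    = d-pos ∘ rot ρ
    ; α-pos    = α-pos ∘ rot ρ
    ; β-pos    = β-pos ∘ rot ρ
    ; balanced = λ i → trans (balanced (rot ρ i)) (cong (λ j → d j * ⟦ β (rot ρ i) ⟧) (sym (Rotation.perm-next ρ i)))
    }

  form-rotate : ∀ g μ → CycleData.form rotateData (g ∘ rot ρ) μ ≡ form g (μ ∘ unrot ρ)
  form-rotate g μ = sym (trans (sum-permute (edgeTerm g ν) (Rotation.perm ρ)) (sum-cong-≗ term))
    where
    ν = μ ∘ unrot ρ
    ν-rot : ∀ i → ν (rot ρ i) ≡ μ i
    ν-rot i = cong μ (Rotation.unrot-rot ρ i)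
    term : ∀ i → edgeTerm g ν (rot ρ i) ≡ CycleData.edgeTerm rotateData (g ∘ rot ρ) μ i
    term i = cong₂ (λ x y → d (rot ρ i) * (x * x) - σ (g (rot ρ i)) * c (rot ρ i) * (x * y))
      (ν-rot i) (trans (cong ν (sym (Rotation.perm-next ρ i))) (ν-rot (next i)))

  Positive-rotate : ∀ g → Positive g → CycleData.Positive rotateData (g ∘ rot ρ)
  Positive-rotate g pos μ (k , μk≢0) = subst (0ℚ <_) (sym (form-rotate g μ))
    (pos (μ ∘ unrot ρ) (rot ρ k , subst (_≢ 0ℚ) (sym (cong μ (Rotation.unrot-rot ρ k))) μk≢0))

  Positive-rotate-firstNegative : Positive firstNegative → CycleData.Positive rotateData firstNegative
  Positive-rotate-firstNegative pos = CycleData.Positive-gauge rotateData (firstNegative ∘ rot ρ) firstNegative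
    (sym (∏±-permute firstNegative (Rotation.perm ρ)))
    (Positive-rotate firstNegative pos)

δ : ∀ {n} → Fin n → Fin n → ℚ
δ i j with i F.≟ j
... | yes _ = 1ℚ
... | no  _ = 0ℚ

δ-refl : ∀ {n} (i : Fin n) → δ i i ≡ 1ℚ
δ-refl i with i F.≟ i
... | yes _   = refl
... | no  i≢i = contradiction refl i≢i

δ-≢ : ∀ {n} {i j : Fin n} → i ≢ j → δ i j ≡ 0ℚ
δ-≢ {i = i} {j} i≢j with i F.≟ j
... | yes i≡j = contradiction i≡j i≢j
... | no  _   = refl

sum-δˡ : ∀ {n} (a : Fin (suc n)) (f : Fin (suc n) → ℚ) → sum (λ j → δ a j * f j) ≡ f a
sum-δˡ a f = trans (sum-single a (λ j j≢a → trans (cong (_* f j) (δ-≢ (j≢a ∘ sym))) (ℚP.*-zeroˡ (f j))))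
                   (trans (cong (_* f a) (δ-refl a)) (ℚP.*-identityˡ (f a)))

sum-δʳ : ∀ {n} (a : Fin (suc n)) (f : Fin (suc n) → ℚ) → sum (λ j → δ j a * f j) ≡ f a
sum-δʳ a f = trans (sum-single a (λ j j≢a → trans (cong (_* f j) (δ-≢ j≢a)) (ℚP.*-zeroˡ (f j))))
                   (trans (cong (_* f a) (δ-refl a)) (ℚP.*-identityˡ (f a)))

module _ {m : ℕ} (2≤m : 2 ℕ.≤ m) (B : Fin (suc m) → Fin (suc m) → ℚ)
         (B-off-cycle : ∀ i j → i ≢ j → j ≢ next i → i ≢ next j → B i j ≡ 0ℚ)
         (B-edge : ∀ i → B (next i) i ≡ B i (next i)) where

  private
    1≤m = ℕP.≤-trans (s≤s z≤n) 2≤m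

    decompose : ∀ i j → B i j ≡ δ i j * B i i + δ (next i) j * B i (next i) + δ i (next j) * B j (next j)
    decompose i j = by-position i j (i F.≟ j) (next i F.≟ j) (i F.≟ next j)
      where
      by-position : ∀ i j → Dec (i ≡ j) → Dec (next i ≡ j) → Dec (i ≡ next j) →
                    B i j ≡ δ i j * B i i + δ (next i) j * B i (next i) + δ i (next j) * B j (next j)
      by-position i .i (yes refl) _ _
        rewrite δ-refl i | δ-≢ (next≢id 1≤m i) | δ-≢ (next≢id 1≤m i ∘ sym) = pick₁ (B i i) (B i (next i)) (B i (next i))
        where pick₁ : ∀ a b c → a ≡ 1ℚ * a + 0ℚ * b + 0ℚ * c
              pick₁ = solve-∀ ℚ-ring
      by-position i .(next i) (no i≢j) (yes refl) _
        rewrite δ-≢ i≢j | δ-refl (next i) | δ-≢ (next²≢id 2≤m i ∘ sym) = pick₂ (B i i) (B i (next i)) (B (next i) (next (next i)))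
        where pick₂ : ∀ a b c → b ≡ 0ℚ * a + 1ℚ * b + 0ℚ * c
              pick₂ = solve-∀ ℚ-ring
      by-position .(next j) j (no i≢j) (no ni≢j) (yes refl)
        rewrite δ-≢ i≢j | δ-≢ ni≢j | δ-refl (next j) =
        trans (B-edge j) (pick₃ (B (next j) (next j)) (B (next j) (next (next j))) (B j (next j)))
        where pick₃ : ∀ a b c → c ≡ 0ℚ * a + 0ℚ * b + 1ℚ * c
              pick₃ = solve-∀ ℚ-ring
      by-position i j (no i≢j) (no ni≢j) (no i≢nj)
        rewrite δ-≢ i≢j | δ-≢ ni≢j | δ-≢ i≢nj =
        trans (B-off-cycle i j i≢j (ni≢j ∘ sym) i≢nj) (none (B i i) (B i (next i)) (B j (next j)))
        where none : ∀ a b c → 0ℚ ≡ 0ℚ * a + 0ℚ * b + 0ℚ * c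
              none = solve-∀ ℚ-ring

  cycle-quadratic-form : ∀ (x : Fin (suc m) → ℚ) → sum (λ i → sum (λ j → x i * B i j * x j))
                             ≡ sum (λ i → x i * B i i * x i + ⟦ 2 ⟧ * (x i * B i (next i) * x (next i)))
  cycle-quadratic-form x = begin
    sum (λ i → sum (λ j → x i * B i j * x j))
      ≡⟨ sum-cong-≗ (λ i → sum-cong-≗ (λ j → trans (cong (λ b → x i * b * x j) (decompose i j)) (spread (x i) (x j) (δ i j) (δ (next i) j) (δ i (next j)) (B i i) (B i (next i)) (B j (next j))))) ⟩
    sum (λ i → sum (λ j → δ i j * diag i j + δ (next i) j * fwd i j + δ i (next j) * bwd i j))
      ≡⟨ sum-cong-≗ (λ i → trans (∑-distrib-+ (λ j → δ i j * diag i j + δ (next i) j * fwd i j) (λ j → δ i (next j) * bwd i j))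
                                   (cong (_+ sum (λ j → δ i (next j) * bwd i j)) (∑-distrib-+ (λ j → δ i j * diag i j) (λ j → δ (next i) j * fwd i j)))) ⟩
    sum (λ i → sum (λ j → δ i j * diag i j) + sum (λ j → δ (next i) j * fwd i j) + sum (λ j → δ i (next j) * bwd i j))
      ≡⟨ ∑-distrib-+ (λ i → sum (λ j → δ i j * diag i j) + sum (λ j → δ (next i) j * fwd i j)) (λ i → sum (λ j → δ i (next j) * bwd i j)) ⟩
    sum (λ i → sum (λ j → δ i j * diag i j) + sum (λ j → δ (next i) j * fwd i j)) + sum (λ i → sum (λ j → δ i (next j) * bwd i j))
      ≡⟨ cong₂ _+_ (sum-cong-≗ (λ i → cong₂ _+_ (sum-δˡ i (diag i)) (sum-δˡ (next i) (fwd i))))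
                   (trans (∑-comm (λ i j → δ i (next j) * bwd i j)) (sum-cong-≗ (λ j → sum-δʳ (next j) (λ i → bwd i j)))) ⟩
    sum (λ i → x i * B i i * x i + x i * B i (next i) * x (next i)) + sum (λ j → x (next j) * B j (next j) * x j)
      ≡⟨ ∑-distrib-+ (λ i → x i * B i i * x i + x i * B i (next i) * x (next i)) (λ j → x (next j) * B j (next j) * x j) ⟨
    sum (λ i → x i * B i i * x i + x i * B i (next i) * x (next i) + x (next i) * B i (next i) * x i)
      ≡⟨ sum-cong-≗ (λ i → double (x i) (B i i) (B i (next i)) (x (next i))) ⟩
    sum (λ i → x i * B i i * x i + ⟦ 2 ⟧ * (x i * B i (next i) * x (next i))) ∎
    where
    open ≡-Reasoning
    diag fwd bwd : Fin (suc m) → Fin (suc m) → ℚ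
    diag i j = x i * B i i * x j
    fwd  i j = x i * B i (next i) * x j
    bwd  i j = x i * B j (next j) * x j
    spread : ∀ xi xj p q r a b c → xi * (p * a + q * b + r * c) * xj ≡ p * (xi * a * xj) + q * (xi * b * xj) + r * (xi * c * xj)
    spread = solve-∀ ℚ-ring
    double : ∀ a b c e → a * b * a + a * c * e + e * c * a ≡ a * b * a + ⟦ 2 ⟧ * (a * c * e)
    double = solve-∀ ℚ-ring

record Realizes {m} (A : Matrix (suc m)) (D : CycleData m) (ε : Fin (suc m) → Sign) : Set where
  field
    diagonal  : DiagTwo A
    off-cycle : ∀ i j → i ≢ j → j ≢ next i → i ≢ next j → A i j ≡ ℤ.+ 0
    forward   : ∀ i → A i (next i) ≡ Sign.opposite (ε i) ◃ CycleData.α D i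
    backward  : ∀ i → A (next i) i ≡ Sign.opposite (ε i) ◃ CycleData.β D i

module _ {m : ℕ} (2≤m : 2 ℕ.≤ m) {A : Matrix (suc m)} {D : CycleData m} {ε : Fin (suc m) → Sign}
         (R : Realizes A D ε) where
  open CycleData D
  open Realizes R

  private
    1≤m = ℕP.≤-trans (s≤s z≤n) 2≤m

    ι-forward : ∀ i → ι (A i (next i)) ≡ - σ (ε i) * ⟦ α i ⟧
    ι-forward i = trans (cong ι (forward i)) (trans (ι-◃ _ (α i)) (cong (_* ⟦ α i ⟧) (σ-opposite (ε i))))

    ι-backward : ∀ i → ι (A (next i) i) ≡ - σ (ε i) * ⟦ β i ⟧
    ι-backward i = trans (cong ι (backward i)) (trans (ι-◃ _ (β i)) (cong (_* ⟦ β i ⟧) (σ-opposite (ε i))))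

    symmetric-edge : ∀ i → d i * ι (A i (next i)) ≡ d (next i) * ι (A (next i) i)
    symmetric-edge i = begin
      d i * ι (A i (next i))                 ≡⟨ cong (d i *_) (ι-forward i) ⟩
      d i * (- σ (ε i) * ⟦ α i ⟧)            ≡⟨ swap (d i) (- σ (ε i)) ⟦ α i ⟧ ⟩
      - σ (ε i) * (d i * ⟦ α i ⟧)            ≡⟨ cong (- σ (ε i) *_) (balanced i) ⟩
      - σ (ε i) * (d (next i) * ⟦ β i ⟧)     ≡⟨ swap (d (next i)) (- σ (ε i)) ⟦ β i ⟧ ⟨
      d (next i) * (- σ (ε i) * ⟦ β i ⟧)     ≡⟨ cong (d (next i) *_) (ι-backward i) ⟨
      d (next i) * ι (A (next i) i)          ∎
      where
      open ≡-Reasoning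
      swap : ∀ x s y → x * (s * y) ≡ s * (x * y)
      swap = solve-∀ ℚ-ring

  realizes-symmetrizer : Symmetrizer A d
  realizes-symmetrizer = d-pos , λ i j → by-position i j (i F.≟ j) (j F.≟ next i) (i F.≟ next j)
    where
    by-position : ∀ i j → Dec (i ≡ j) → Dec (j ≡ next i) → Dec (i ≡ next j) → d i * ι (A i j) ≡ d j * ι (A j i)
    by-position i .i (yes refl) _ _ = refl
    by-position i .(next i) (no _) (yes refl) _ = symmetric-edge i
    by-position .(next j) j (no _) (no _) (yes refl) = sym (symmetric-edge j)
    by-position i j (no i≢j) (no j≢ni) (no i≢nj) =
      trans (cong (λ a → d i * ι a) (off-cycle i j i≢j j≢ni i≢nj))
            (trans (ℚP.*-zeroʳ (d i)) (sym (trans (cong (λ a → d j * ι a) (off-cycle j i (i≢j ∘ sym) i≢nj j≢ni)) (ℚP.*-zeroʳ (d j)))))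

  DA-quadratic-form : ∀ x → Σℚ (suc m) (λ i → Σℚ (suc m) (λ j → x i * DA A d i j * x j)) ≡ ⟦ 2 ⟧ * form ε x
  DA-quadratic-form x = begin
    Σℚ (suc m) (λ i → Σℚ (suc m) (λ j → x i * DA A d i j * x j))
      ≡⟨ trans (Σℚ≡sum (suc m) (λ i → Σℚ (suc m) (λ j → x i * DA A d i j * x j)))
               (sum-cong-≗ (λ i → Σℚ≡sum (suc m) (λ j → x i * DA A d i j * x j))) ⟩
    sum (λ i → sum (λ j → x i * DA A d i j * x j))
      ≡⟨ cycle-quadratic-form 2≤m (DA A d) B-off-cycle (sym ∘ symmetric-edge) x ⟩
    sum (λ i → x i * DA A d i i * x i + ⟦ 2 ⟧ * (x i * DA A d i (next i) * x (next i)))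
      ≡⟨ sum-cong-≗ term ⟩
    sum (λ i → ⟦ 2 ⟧ * edgeTerm ε x i)
      ≡⟨ *-distribˡ-sum ⟦ 2 ⟧ (edgeTerm ε x) ⟨
    ⟦ 2 ⟧ * form ε x ∎
    where
    open ≡-Reasoning
    B-off-cycle : ∀ i j → i ≢ j → j ≢ next i → i ≢ next j → DA A d i j ≡ 0ℚ
    B-off-cycle i j i≢j j≢ni i≢nj = trans (cong (λ a → d i * ι a) (off-cycle i j i≢j j≢ni i≢nj)) (ℚP.*-zeroʳ (d i))
    halve : ∀ x D s a y → x * (D * ⟦ 2 ⟧) * x + ⟦ 2 ⟧ * (x * (D * (- s * a)) * y) ≡ ⟦ 2 ⟧ * (D * (x * x) - s * (D * a) * (x * y))
    halve = solve-∀ ℚ-ring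
    term : ∀ i → x i * DA A d i i * x i + ⟦ 2 ⟧ * (x i * DA A d i (next i) * x (next i)) ≡ ⟦ 2 ⟧ * edgeTerm ε x i
    term i = trans (cong₂ (λ a b → x i * (d i * a) * x i + ⟦ 2 ⟧ * (x i * (d i * b) * x (next i))) (cong ι (diagonal i)) (ι-forward i))
                   (halve (x i) (d i) (σ (ε i)) ⟦ α i ⟧ (x (next i)))

  realizes-positive : PositiveDefinite (DA A d) → Positive ε
  realizes-positive pd μ μ≢0 = *-cancelˡ-pos (⟦⟧-pos {2} (s≤s z≤n)) (subst (0ℚ <_) (DA-quadratic-form μ) (pd μ μ≢0))

  positive-realizes : Positive ε → PositiveDefinite (DA A d)
  positive-realizes pos x x≢0 = subst (0ℚ <_) (sym (DA-quadratic-form x)) (*-pos (⟦⟧-pos {2} (s≤s z≤n)) (pos x x≢0))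

  realizes-diagram : IsDiagramOf A weight ε
  realizes-diagram = (λ i j i≢j → nonzero⇒adjacent i j i≢j , adjacent⇒nonzero i j) , weights , signs
    where
    ◃-nonzero : ∀ s {n} → 1 ℕ.≤ n → s ◃ n ≢ ℤ.+ 0
    ◃-nonzero s {n} 1≤n eq = ℕP.<⇒≢ 1≤n (sym (trans (sym (ℤP.abs-◃ s n)) (cong ∣_∣ eq)))
    sign-◃ : ∀ s {n} → 1 ℕ.≤ n → sign (s ◃ n) ≡ s
    sign-◃ s {suc n} _ = ℤP.sign-◃ s (suc n)
    nonzero⇒adjacent : ∀ i j → i ≢ j → ¬ (A i j ≡ ℤ.+ 0) → Adjacent i j
    nonzero⇒adjacent i j i≢j Aij≢0 with j F.≟ next i | i F.≟ next j
    ... | yes j≡ni | _        = inj₁ j≡ni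
    ... | no _     | yes i≡nj = inj₂ i≡nj
    ... | no j≢ni  | no i≢nj  = contradiction (off-cycle i j i≢j j≢ni i≢nj) Aij≢0
    adjacent⇒nonzero : ∀ i j → Adjacent i j → ¬ (A i j ≡ ℤ.+ 0)
    adjacent⇒nonzero i .(next i) (inj₁ refl) = ◃-nonzero _ (α-pos i) ∘ trans (sym (forward i))
    adjacent⇒nonzero .(next j) j (inj₂ refl) = ◃-nonzero _ (β-pos j) ∘ trans (sym (backward j))
    weights : ∀ k → A k (next k) ℤ.* A (next k) k ≡ ℤ.+ weight k
    weights k = begin
      A k (next k) ℤ.* A (next k) k                     ≡⟨ cong₂ ℤ._*_ (forward k) (backward k) ⟩
      (s ◃ α k) ℤ.* (s ◃ β k)                           ≡⟨ ℤP.◃-distrib-* s s (α k) (β k) ⟨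
      (s Sign.* s) ◃ weight k                           ≡⟨ cong (_◃ weight k) (SignP.s*s≡+ s) ⟩
      Sign.+ ◃ weight k                                 ≡⟨ ℤP.+◃n≡+n (weight k) ⟩
      ℤ.+ weight k                                      ∎
      where
      open ≡-Reasoning
      s = Sign.opposite (ε k)
    signs : ∀ k → (Sign.opposite (sign (A k (next k))) ≡ ε k) × (Sign.opposite (sign (A (next k) k)) ≡ ε k)
    signs k = trans (cong (Sign.opposite ∘ sign) (forward k)) (trans (cong Sign.opposite (sign-◃ _ (α-pos k))) (SignP.opposite-involutive (ε k)))
            , trans (cong (Sign.opposite ∘ sign) (backward k)) (trans (cong Sign.opposite (sign-◃ _ (β-pos k))) (SignP.opposite-involutive (ε k)))

module _ {m : ℕ} (2≤m : 2 ℕ.≤ m) (D : CycleData m) (ε : Fin (suc m) → Sign) where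
  open CycleData D

  private
    1≤m = ℕP.≤-trans (s≤s z≤n) 2≤m

    entry : ∀ i j → Dec (i ≡ j) → Dec (j ≡ next i) → Dec (i ≡ next j) → ℤ
    entry i j (yes _) _       _       = ℤ.+ 2
    entry i j (no _)  (yes _) _       = Sign.opposite (ε i) ◃ α i
    entry i j (no _)  (no _)  (yes _) = Sign.opposite (ε j) ◃ β j
    entry i j (no _)  (no _)  (no _)  = ℤ.+ 0

  cycleMatrix : Matrix (suc m)
  cycleMatrix i j = entry i j (i F.≟ j) (j F.≟ next i) (i F.≟ next j)

  cycleMatrix-realizes : Realizes cycleMatrix D ε
  cycleMatrix-realizes = record
    { diagonal  = λ i → diagonal i (i F.≟ i) (i F.≟ next i) (i F.≟ next i)
    ; off-cycle = λ i j → off-cycle i j (i F.≟ j) (j F.≟ next i) (i F.≟ next j)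
    ; forward   = λ i → forward i (i F.≟ next i) (next i F.≟ next i) (i F.≟ next (next i))
    ; backward  = λ i → backward i (next i F.≟ i) (i F.≟ next (next i)) (next i F.≟ next i)
    }
    where
    diagonal : ∀ i p q r → entry i i p q r ≡ ℤ.+ 2
    diagonal i (yes _)  _ _ = refl
    diagonal i (no i≢i) _ _ = contradiction refl i≢i
    off-cycle : ∀ i j p q r → i ≢ j → j ≢ next i → i ≢ next j → entry i j p q r ≡ ℤ.+ 0
    off-cycle i j (yes i≡j) _ _ i≢j _ _ = contradiction i≡j i≢j
    off-cycle i j (no _) (yes j≡ni) _ _ j≢ni _ = contradiction j≡ni j≢ni
    off-cycle i j (no _) (no _) (yes i≡nj) _ _ i≢nj = contradiction i≡nj i≢nj
    off-cycle i j (no _) (no _) (no _) _ _ _ = refl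
    forward : ∀ i p q r → entry i (next i) p q r ≡ Sign.opposite (ε i) ◃ α i
    forward i (yes i≡ni) _ _ = contradiction (sym i≡ni) (next≢id 1≤m i)
    forward i (no _) (yes _) _ = refl
    forward i (no _) (no ni≢ni) _ = contradiction refl ni≢ni
    backward : ∀ i p q r → entry (next i) i p q r ≡ Sign.opposite (ε i) ◃ β i
    backward i (yes ni≡i) _ _ = contradiction ni≡i (next≢id 1≤m i)
    backward i (no _) (yes i≡nni) _ = contradiction (sym i≡nni) (next²≢id 2≤m i)
    backward i (no _) (no _) (yes _) = refl
    backward i (no _) (no _) (no ni≢ni) = contradiction refl ni≢ni

module FromMatrix {m : ℕ} (2≤m : 2 ℕ.≤ m) {w : Fin (suc m) → ℕ} {ε : Fin (suc m) → Sign} {A : Matrix (suc m)}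
                  (pq : IsPositiveQuasiCartan A) (dg : IsDiagramOf A w ε) where

  private
    1≤m = ℕP.≤-trans (s≤s z≤n) 2≤m
    d = proj₁ (proj₂ pq)
    adjacency = proj₁ dg
    entry-weights = proj₁ (proj₂ dg)
    entry-signs = proj₂ (proj₂ dg)

    forward-nonzero : ∀ i → A i (next i) ≢ ℤ.+ 0
    forward-nonzero i = proj₂ (adjacency i (next i) (next≢id 1≤m i ∘ sym)) (inj₁ refl)

    backward-nonzero : ∀ i → A (next i) i ≢ ℤ.+ 0
    backward-nonzero i = proj₂ (adjacency (next i) i (next≢id 1≤m i)) (inj₂ refl)

    ∣∣-pos : ∀ {a} → a ≢ ℤ.+ 0 → 1 ℕ.≤ ∣ a ∣
    ∣∣-pos a≢0 = ℕP.n≢0⇒n>0 (a≢0 ∘ ℤP.∣i∣≡0⇒i≡0)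

    signed-abs : ∀ {a e} → Sign.opposite (sign a) ≡ e → a ≡ Sign.opposite e ◃ ∣ a ∣
    signed-abs {a} refl = trans (sym (ℤP.◃-inverse a)) (cong (_◃ ∣ a ∣) (sym (SignP.opposite-involutive (sign a))))

    forward : ∀ i → A i (next i) ≡ Sign.opposite (ε i) ◃ ∣ A i (next i) ∣
    forward i = signed-abs (proj₁ (entry-signs i))

    backward : ∀ i → A (next i) i ≡ Sign.opposite (ε i) ◃ ∣ A (next i) i ∣
    backward i = signed-abs (proj₂ (entry-signs i))

    balanced : ∀ i → d i * ⟦ ∣ A i (next i) ∣ ⟧ ≡ d (next i) * ⟦ ∣ A (next i) i ∣ ⟧
    balanced i = σ-cancel (Sign.opposite (ε i)) (begin
      s * (d i * ⟦ ∣ A i (next i) ∣ ⟧)                  ≡⟨ swap s (d i) _ ⟩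
      d i * (s * ⟦ ∣ A i (next i) ∣ ⟧)                  ≡⟨ cong (d i *_) (ι-◃ (Sign.opposite (ε i)) ∣ A i (next i) ∣) ⟨
      d i * ι (Sign.opposite (ε i) ◃ ∣ A i (next i) ∣)   ≡⟨ cong (λ a → d i * ι a) (forward i) ⟨
      d i * ι (A i (next i))                            ≡⟨ proj₂ (proj₁ (proj₂ (proj₂ pq))) i (next i) ⟩
      d (next i) * ι (A (next i) i)                     ≡⟨ cong (λ a → d (next i) * ι a) (backward i) ⟩
      d (next i) * ι (Sign.opposite (ε i) ◃ ∣ A (next i) i ∣) ≡⟨ cong (d (next i) *_) (ι-◃ (Sign.opposite (ε i)) ∣ A (next i) i ∣) ⟩
      d (next i) * (s * ⟦ ∣ A (next i) i ∣ ⟧)           ≡⟨ swap s (d (next i)) _ ⟨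
      s * (d (next i) * ⟦ ∣ A (next i) i ∣ ⟧)           ∎)
      where
      open ≡-Reasoning
      s = σ (Sign.opposite (ε i))
      swap : ∀ s x y → s * (x * y) ≡ x * (s * y)
      swap = solve-∀ ℚ-ring

  cycleData : CycleData m
  cycleData = record
    { d        = d
    ; α        = λ i → ∣ A i (next i) ∣
    ; β        = λ i → ∣ A (next i) i ∣
    ; d-pos    = proj₁ (proj₁ (proj₂ (proj₂ pq)))
    ; α-pos    = ∣∣-pos ∘ forward-nonzero
    ; β-pos    = ∣∣-pos ∘ backward-nonzero
    ; balanced = balanced
    }

  realizes : Realizes A cycleData ε
  realizes = record
    { diagonal  = proj₁ pq
    ; off-cycle = off-cycle
    ; forward   = forward
    ; backward  = backward
    }
    where
    off-cycle : ∀ i j → i ≢ j → j ≢ next i → i ≢ next j → A i j ≡ ℤ.+ 0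
    off-cycle i j i≢j j≢ni i≢nj with A i j ℤP.≟ ℤ.+ 0
    ... | yes Aij≡0 = Aij≡0
    ... | no  Aij≢0 with proj₁ (adjacency i j i≢j) Aij≢0
    ...   | inj₁ j≡ni = contradiction j≡ni j≢ni
    ...   | inj₂ i≡nj = contradiction i≡nj i≢nj

  weight≗w : ∀ i → CycleData.weight cycleData i ≡ w i
  weight≗w i = trans (sym (ℤP.abs-* (A i (next i)) (A (next i) i))) (cong ∣_∣ (entry-weights i))

  positive : CycleData.Positive cycleData ε
  positive = realizes-positive 2≤m realizes (proj₂ (proj₂ (proj₂ pq)))

-- Necessary conditions

∏ℚ-pos : ∀ {n} {f : Fin n → ℚ} → (∀ i → 0ℚ < f i) → 0ℚ < ∏ℚ f
∏ℚ-pos {zero}  0<f = ℚP.positive⁻¹ 1ℚ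
∏ℚ-pos {suc n} 0<f = *-pos (0<f zero) (∏ℚ-pos (0<f ∘ suc))

∏ℚ-⟦⟧ : ∀ {n} (f : Fin n → ℕ) → ∏ℚ (⟦_⟧ ∘ f) ≡ ⟦ ∏ℕ f ⟧
∏ℚ-⟦⟧ {zero}  f = refl
∏ℚ-⟦⟧ {suc n} f = trans (cong (⟦ f zero ⟧ *_) (∏ℚ-⟦⟧ (f ∘ suc))) (sym (⟦⟧-homo-* (f zero) (∏ℕ (f ∘ suc))))

*-cancelˡ-≡-pos : ∀ {p q r} → 0ℚ < p → p * q ≡ p * r → q ≡ r
*-cancelˡ-≡-pos {p} 0<p eq = ℚP.≤-antisym
  (ℚP.*-cancelˡ-≤-pos p {{ℚ.positive 0<p}} (ℚP.≤-reflexive eq))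
  (ℚP.*-cancelˡ-≤-pos p {{ℚ.positive 0<p}} (ℚP.≤-reflexive (sym eq)))

module _ {m : ℕ} (D : CycleData m) where
  open CycleData D

  ∏α≡∏β : ∏ℕ α ≡ ∏ℕ β
  ∏α≡∏β = ⟦⟧-injective (*-cancelˡ-≡-pos (∏ℚ-pos d-pos) (begin
    ∏ℚ d * ⟦ ∏ℕ α ⟧                          ≡⟨ cong (∏ℚ d *_) (∏ℚ-⟦⟧ α) ⟨
    ∏ℚ d * ∏ℚ (⟦_⟧ ∘ α)                      ≡⟨ ∏ℚ-distrib-* d (⟦_⟧ ∘ α) ⟨
    ∏ℚ (λ i → d i * ⟦ α i ⟧)                 ≡⟨ ∏ℚ-cong-≗ balanced ⟩
    ∏ℚ (λ i → d (next i) * ⟦ β i ⟧)          ≡⟨ ∏ℚ-distrib-* (d ∘ next) (⟦_⟧ ∘ β) ⟩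
    ∏ℚ (d ∘ next) * ∏ℚ (⟦_⟧ ∘ β)             ≡⟨ cong₂ _*_ (sym (∏ℚ-permute d nextPerm)) (∏ℚ-⟦⟧ β) ⟩
    ∏ℚ d * ⟦ ∏ℕ β ⟧                          ∎))
    where open ≡-Reasoning

  c-at : ∀ {i a} → α i ≡ a → c i ≡ d i * ⟦ a ⟧
  c-at {i} refl = refl

  balanced-gap : ∀ {i a b} → α i ≡ a → β i ≡ b → d (next i) * ⟦ b ⟧ - d i * ⟦ a ⟧ ≡ 0ℚ
  balanced-gap {i} refl refl = trans (cong (_- c i) (sym (balanced i))) (ℚP.+-inverseʳ (c i))

  +-vanishing : ∀ {x t} → t ≡ 0ℚ → x + t ≡ x
  +-vanishing {x} refl = ℚP.+-identityʳ x

  vanishing-terms : ∀ {n} (k : Fin n → Fin (suc m)) (g : Fin (suc m) → Sign) →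
    sum (λ i → d (k i) * (0ℚ * 0ℚ) - σ (g (k i)) * c (k i) * (0ℚ * 0ℚ)) ≡ 0ℚ
  vanishing-terms k g = sum-zero (λ i → zero-term (d (k i)) (σ (g (k i))) (c (k i)))
    where
    zero-term : ∀ a b c → a * (0ℚ * 0ℚ) - b * c * (0ℚ * 0ℚ) ≡ 0ℚ
    zero-term = solve-∀ ℚ-ring

  -- Test vectors are written as functions on ℕ, read off on the vertices 0, 1, …, m.
  form-on-ℕ : ∀ g (u : ℕ → ℚ) → u (suc m) ≡ u 0 →
              form g (u ∘ toℕ) ≡ sum (λ i → d i * (u (toℕ i) * u (toℕ i)) - σ (g i) * c i * (u (toℕ i) * u (suc (toℕ i))))
  form-on-ℕ g u wrap = sum-cong-≗ (λ i → cong (λ x → d i * (u (toℕ i) * u (toℕ i)) - σ (g i) * c i * (u (toℕ i) * x)) (u-next i))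
    where
    u-next : ∀ i → u (toℕ (next i)) ≡ u (suc (toℕ i))
    u-next i with toℕ-next i
    ... | inj₁ t       = cong u t
    ... | inj₂ (t , z) = trans (cong (u ∘ toℕ) z) (trans (sym wrap) (cong (u ∘ suc) (sym t)))

module _ {m : ℕ} (D : CycleData (suc (suc m))) (pos : CycleData.Positive D firstNegative) where
  open CycleData D

  edge-test : weight (suc zero) ℕ.< 4
  edge-test = ⟦⟧-cancel-< (subst (_< ⟦ 4 ⟧) (sym (⟦⟧-homo-* (α (suc zero)) (β (suc zero))))
    (0<-⇒< (*-cancelˡ-pos (d-pos (suc zero)) (subst (0ℚ <_) value (pos (u ∘ toℕ) (suc zero , λ ()))))))
    where
    d₀ = d zero
    d₁ = d (suc zero)
    d₂ = d (suc (suc zero))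
    c₁ = c (suc zero)
    b = ⟦ β (suc zero) ⟧
    u : ℕ → ℚ
    u 1 = ⟦ 2 ⟧
    u 2 = b
    u _ = 0ℚ
    expand : ∀ d₀ d₁ d₂ c₀ c₁ c₂ b t →
      d₀ * (0ℚ * 0ℚ) - - 1ℚ * c₀ * (0ℚ * ⟦ 2 ⟧) + (d₁ * (⟦ 2 ⟧ * ⟦ 2 ⟧) - 1ℚ * c₁ * (⟦ 2 ⟧ * b)
        + (d₂ * (b * b) - 1ℚ * c₂ * (b * 0ℚ) + t))
      ≡ ⟦ 4 ⟧ * d₁ - ⟦ 2 ⟧ * c₁ * b + d₂ * b * b + t
    expand = solve-∀ ℚ-ring
    value : form firstNegative (u ∘ toℕ) ≡ d₁ * (⟦ 4 ⟧ - ⟦ α (suc zero) ⟧ * b)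
    value = begin
      form firstNegative (u ∘ toℕ)
        ≡⟨ trans (form-on-ℕ D firstNegative u refl) (trans (expand d₀ d₁ d₂ (c zero) c₁ (c (suc (suc zero))) b _)
                 (+-vanishing D (vanishing-terms D {m} (λ i → suc (suc (suc i))) firstNegative))) ⟩
      ⟦ 4 ⟧ * d₁ - ⟦ 2 ⟧ * c₁ * b + d₂ * b * b
        ≡⟨ cong (λ x → ⟦ 4 ⟧ * d₁ - ⟦ 2 ⟧ * c₁ * b + x * b) (sym (balanced (suc zero))) ⟩
      ⟦ 4 ⟧ * d₁ - ⟦ 2 ⟧ * c₁ * b + c₁ * b
        ≡⟨ simplify d₁ ⟦ α (suc zero) ⟧ b ⟩
      d₁ * (⟦ 4 ⟧ - ⟦ α (suc zero) ⟧ * b) ∎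
      where
      open ≡-Reasoning
      simplify : ∀ d a b → ⟦ 4 ⟧ * d - ⟦ 2 ⟧ * (d * a) * b + (d * a) * b ≡ d * (⟦ 4 ⟧ - a * b)
      simplify = solve-∀ ℚ-ring

module _ {m : ℕ} (D : CycleData (suc (suc (suc m)))) (pos : CycleData.Positive D firstNegative) where
  open CycleData D

  path-test : weight (suc zero) ℕ.+ weight (suc (suc zero)) ℕ.< 4
  path-test = ⟦⟧-cancel-< (subst (_< ⟦ 4 ⟧) (sym weights)
    (0<-⇒< (*-cancelˡ-pos (d-pos (suc (suc zero))) (subst (0ℚ <_) value (pos (u ∘ toℕ) (suc (suc zero) , λ ()))))))
    where
    d₂ = d (suc (suc zero))
    d₃ = d (suc (suc (suc zero)))
    c₁ = c (suc zero)
    c₂ = c (suc (suc zero))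
    a₁ = ⟦ α (suc zero) ⟧
    b₁ = ⟦ β (suc zero) ⟧
    a₂ = ⟦ α (suc (suc zero)) ⟧
    b₂ = ⟦ β (suc (suc zero)) ⟧
    weights : ⟦ weight (suc zero) ℕ.+ weight (suc (suc zero)) ⟧ ≡ a₁ * b₁ + a₂ * b₂
    weights = trans (⟦⟧-homo-+ (weight (suc zero)) (weight (suc (suc zero))))
                    (cong₂ _+_ (⟦⟧-homo-* (α (suc zero)) (β (suc zero))) (⟦⟧-homo-* (α (suc (suc zero))) (β (suc (suc zero)))))
    u : ℕ → ℚ
    u 1 = a₁
    u 2 = ⟦ 2 ⟧
    u 3 = b₂
    u _ = 0ℚ
    expand : ∀ d₀ d₁ d₂ d₃ c₀ c₁ c₂ c₃ a₁ b₂ t →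
      d₀ * (0ℚ * 0ℚ) - - 1ℚ * c₀ * (0ℚ * a₁) + (d₁ * (a₁ * a₁) - 1ℚ * c₁ * (a₁ * ⟦ 2 ⟧)
        + (d₂ * (⟦ 2 ⟧ * ⟦ 2 ⟧) - 1ℚ * c₂ * (⟦ 2 ⟧ * b₂) + (d₃ * (b₂ * b₂) - 1ℚ * c₃ * (b₂ * 0ℚ) + t)))
      ≡ d₁ * a₁ * a₁ - ⟦ 2 ⟧ * c₁ * a₁ + ⟦ 4 ⟧ * d₂ - ⟦ 2 ⟧ * c₂ * b₂ + d₃ * b₂ * b₂ + t
    expand = solve-∀ ℚ-ring
    value : form firstNegative (u ∘ toℕ) ≡ d₂ * (⟦ 4 ⟧ - (a₁ * b₁ + a₂ * b₂))
    value = begin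
      form firstNegative (u ∘ toℕ)
        ≡⟨ trans (form-on-ℕ D firstNegative u refl)
                 (trans (expand (d zero) (d (suc zero)) d₂ d₃ (c zero) c₁ c₂ (c (suc (suc (suc zero)))) a₁ b₂ _)
                        (+-vanishing D (vanishing-terms D {m} (λ i → suc (suc (suc (suc i)))) firstNegative))) ⟩
      c₁ * a₁ - ⟦ 2 ⟧ * c₁ * a₁ + ⟦ 4 ⟧ * d₂ - ⟦ 2 ⟧ * c₂ * b₂ + d₃ * b₂ * b₂
        ≡⟨ cong₂ (λ x y → x * a₁ - ⟦ 2 ⟧ * x * a₁ + ⟦ 4 ⟧ * d₂ - ⟦ 2 ⟧ * c₂ * b₂ + y * b₂)
                 (balanced (suc zero)) (sym (balanced (suc (suc zero)))) ⟩
      d₂ * b₁ * a₁ - ⟦ 2 ⟧ * (d₂ * b₁) * a₁ + ⟦ 4 ⟧ * d₂ - ⟦ 2 ⟧ * (d₂ * a₂) * b₂ + d₂ * a₂ * b₂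
        ≡⟨ simplify d₂ a₁ b₁ a₂ b₂ ⟩
      d₂ * (⟦ 4 ⟧ - (a₁ * b₁ + a₂ * b₂)) ∎
      where
      open ≡-Reasoning
      simplify : ∀ d a₁ b₁ a₂ b₂ → d * b₁ * a₁ - ⟦ 2 ⟧ * (d * b₁) * a₁ + ⟦ 4 ⟧ * d - ⟦ 2 ⟧ * (d * a₂) * b₂ + d * a₂ * b₂
                                   ≡ d * (⟦ 4 ⟧ - (a₁ * b₁ + a₂ * b₂))
      simplify = solve-∀ ℚ-ring

module _ {m : ℕ} (D : CycleData (suc (suc (suc (suc m))))) (pos : CycleData.Positive D firstNegative) where
  open CycleData D

  private
    v₁ v₂ v₃ : Fin (suc (suc (suc (suc (suc m)))))
    v₁ = suc zero
    v₂ = suc (suc zero)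
    v₃ = suc (suc (suc zero))

  -- The path with weights 2, 1, 2 is affine: (1, 2, 2, 1) is a null vector of its form.
  affine-path-test : α v₁ ≡ 1 → β v₁ ≡ 2 → α v₂ ≡ 1 → β v₂ ≡ 1 → α v₃ ≡ 2 → β v₃ ≡ 1 → ⊥
  affine-path-test a₁ b₁ a₂ b₂ a₃ b₃ = ℚP.<-irrefl (sym value) (pos (u ∘ toℕ) (v₁ , λ ()))
    where
    d₁ = d v₁
    d₂ = d v₂
    d₃ = d v₃
    d₄ = d (suc (suc (suc (suc zero))))
    u : ℕ → ℚ
    u 1 = 1ℚ
    u 2 = ⟦ 2 ⟧
    u 3 = ⟦ 2 ⟧
    u 4 = 1ℚ
    u _ = 0ℚ
    expand : ∀ d₀ d₁ d₂ d₃ d₄ c₀ c₁ c₂ c₃ c₄ t →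
      d₀ * (0ℚ * 0ℚ) - - 1ℚ * c₀ * (0ℚ * 1ℚ) + (d₁ * (1ℚ * 1ℚ) - 1ℚ * c₁ * (1ℚ * ⟦ 2 ⟧)
        + (d₂ * (⟦ 2 ⟧ * ⟦ 2 ⟧) - 1ℚ * c₂ * (⟦ 2 ⟧ * ⟦ 2 ⟧) + (d₃ * (⟦ 2 ⟧ * ⟦ 2 ⟧) - 1ℚ * c₃ * (⟦ 2 ⟧ * 1ℚ)
        + (d₄ * (1ℚ * 1ℚ) - 1ℚ * c₄ * (1ℚ * 0ℚ) + t))))
      ≡ d₁ - ⟦ 2 ⟧ * c₁ + ⟦ 4 ⟧ * (d₂ - c₂) + ⟦ 4 ⟧ * d₃ - ⟦ 2 ⟧ * c₃ + d₄ + t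
    expand = solve-∀ ℚ-ring
    rearrange : ∀ d₁ d₂ d₃ d₄ → d₁ - ⟦ 2 ⟧ * (d₁ * ⟦ 1 ⟧) + ⟦ 4 ⟧ * (d₂ - d₂ * ⟦ 1 ⟧) + ⟦ 4 ⟧ * d₃ - ⟦ 2 ⟧ * (d₃ * ⟦ 2 ⟧) + d₄
                                ≡ (d₂ * ⟦ 2 ⟧ - d₁ * ⟦ 1 ⟧) + ⟦ 2 ⟧ * (d₃ * ⟦ 1 ⟧ - d₂ * ⟦ 1 ⟧) + (d₄ * ⟦ 1 ⟧ - d₃ * ⟦ 2 ⟧)
    rearrange = solve-∀ ℚ-ring
    value : form firstNegative (u ∘ toℕ) ≡ 0ℚ
    value = begin
      form firstNegative (u ∘ toℕ)
        ≡⟨ trans (form-on-ℕ D firstNegative u refl)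
                 (trans (expand (d zero) d₁ d₂ d₃ d₄ (c zero) (c v₁) (c v₂) (c v₃) (c (suc (suc (suc (suc zero))))) _)
                        (+-vanishing D (vanishing-terms D {m} (λ i → suc (suc (suc (suc (suc i))))) firstNegative))) ⟩
      d₁ - ⟦ 2 ⟧ * c v₁ + ⟦ 4 ⟧ * (d₂ - c v₂) + ⟦ 4 ⟧ * d₃ - ⟦ 2 ⟧ * c v₃ + d₄
        ≡⟨ cong₂ (λ x y → d₁ - ⟦ 2 ⟧ * x + ⟦ 4 ⟧ * (d₂ - y) + ⟦ 4 ⟧ * d₃ - ⟦ 2 ⟧ * c v₃ + d₄) (c-at D a₁) (c-at D a₂) ⟩
      d₁ - ⟦ 2 ⟧ * (d₁ * ⟦ 1 ⟧) + ⟦ 4 ⟧ * (d₂ - d₂ * ⟦ 1 ⟧) + ⟦ 4 ⟧ * d₃ - ⟦ 2 ⟧ * c v₃ + d₄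
        ≡⟨ cong (λ x → d₁ - ⟦ 2 ⟧ * (d₁ * ⟦ 1 ⟧) + ⟦ 4 ⟧ * (d₂ - d₂ * ⟦ 1 ⟧) + ⟦ 4 ⟧ * d₃ - ⟦ 2 ⟧ * x + d₄) (c-at D a₃) ⟩
      d₁ - ⟦ 2 ⟧ * (d₁ * ⟦ 1 ⟧) + ⟦ 4 ⟧ * (d₂ - d₂ * ⟦ 1 ⟧) + ⟦ 4 ⟧ * d₃ - ⟦ 2 ⟧ * (d₃ * ⟦ 2 ⟧) + d₄
        ≡⟨ rearrange d₁ d₂ d₃ d₄ ⟩
      (d₂ * ⟦ 2 ⟧ - d₁ * ⟦ 1 ⟧) + ⟦ 2 ⟧ * (d₃ * ⟦ 1 ⟧ - d₂ * ⟦ 1 ⟧) + (d₄ * ⟦ 1 ⟧ - d₃ * ⟦ 2 ⟧)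
        ≡⟨ cong₂ (λ x y → x + ⟦ 2 ⟧ * y + (d₄ * ⟦ 1 ⟧ - d₃ * ⟦ 2 ⟧)) (balanced-gap D a₁ b₁) (balanced-gap D a₂ b₂) ⟩
      0ℚ + ⟦ 2 ⟧ * 0ℚ + (d₄ * ⟦ 1 ⟧ - d₃ * ⟦ 2 ⟧)
        ≡⟨ cong (λ x → 0ℚ + ⟦ 2 ⟧ * 0ℚ + x) (balanced-gap D a₃ b₃) ⟩
      0ℚ + ⟦ 2 ⟧ * 0ℚ + 0ℚ
        ≡⟨⟩
      0ℚ ∎
      where open ≡-Reasoning

module _ {m : ℕ} (D : CycleData (suc m)) (pos : CycleData.Positive D firstNegative) where
  open CycleData D

  private
    last : Fin (suc (suc m))
    last = fromℕ (suc m)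

    μ : Fin (suc (suc m)) → ℚ
    μ zero    = 0ℚ
    μ (suc _) = 1ℚ

    μ≡1 : ∀ {j} → j ≢ zero → μ j ≡ 1ℚ
    μ≡1 {zero}  j≢0 = contradiction refl j≢0
    μ≡1 {suc _} _   = refl

    inner-term : ∀ j → suc j ≢ last → edgeTerm firstNegative μ (suc j) ≡ d (suc j) - c (suc j)
    inner-term j sj≢last = trans (cong (λ x → d (suc j) * (1ℚ * 1ℚ) - 1ℚ * c (suc j) * (1ℚ * x)) (μ≡1 (sj≢last ∘ next≡zero⇒fromℕ)))
                                 (ones (d (suc j)) (c (suc j)))
      where
      ones : ∀ x y → x * (1ℚ * 1ℚ) - 1ℚ * y * (1ℚ * 1ℚ) ≡ x - y
      ones = solve-∀ ℚ-ring

    last-term : edgeTerm firstNegative μ last ≡ d last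
    last-term = trans (cong (λ x → d last * (1ℚ * 1ℚ) - 1ℚ * c last * (1ℚ * μ x)) next-fromℕ) (end (d last) (c last))
      where
      end : ∀ x y → x * (1ℚ * 1ℚ) - 1ℚ * y * (1ℚ * 0ℚ) ≡ x
      end = solve-∀ ℚ-ring

    nonpositive-term : ∀ i → i ≢ last → edgeTerm firstNegative μ i ≤ 0ℚ
    nonpositive-term zero    _       = ℚP.≤-reflexive (zero-start (d zero) (c zero) (μ (next zero)))
      where
      zero-start : ∀ x y z → x * (0ℚ * 0ℚ) - - 1ℚ * y * (0ℚ * z) ≡ 0ℚ
      zero-start = solve-∀ ℚ-ring
    nonpositive-term (suc j) sj≢last =
      subst (_≤ 0ℚ) (sym (inner-term j sj≢last)) (≤⇒-≤0 (≤-*⟦⟧ (α (suc j)) (d-pos (suc j)) (α-pos (suc j))))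

  deletion-test : ∀ u → u ≢ zero → u ≢ last → 2 ℕ.≤ α u → d u < d last
  deletion-test zero    u≢0 _       _    = contradiction refl u≢0
  deletion-test (suc j) _   u≢last 2≤αu = 0<-⇒< (ℚP.<-≤-trans (pos μ (last , λ ())) (begin
    form firstNegative μ                                          ≤⟨ sum-≤-two-terms (u≢last ∘ sym) (λ i i≢last _ → nonpositive-term i i≢last) ⟩
    edgeTerm firstNegative μ last + edgeTerm firstNegative μ (suc j) ≡⟨ cong₂ _+_ last-term (inner-term j u≢last) ⟩
    d last + (d (suc j) - c (suc j))                              ≤⟨ ℚP.+-monoʳ-≤ (d last) (ℚP.+-monoʳ-≤ (d (suc j)) (ℚP.neg-antimono-≤ twice)) ⟩
    d last + (d (suc j) - d (suc j) * ⟦ 2 ⟧)                       ≡⟨ tidy (d last) (d (suc j)) ⟩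
    d last - d (suc j)                                            ∎))
    where
    open ℚP.≤-Reasoning
    twice : d (suc j) * ⟦ 2 ⟧ ≤ c (suc j)
    twice = ℚP.*-monoˡ-≤-nonNeg (d (suc j)) {{ℚ.nonNegative (ℚP.<⇒≤ (d-pos (suc j)))}} (⟦⟧-mono-≤ 2≤αu)
    tidy : ∀ x y → x + (y - y * ⟦ 2 ⟧) ≡ x - y
    tidy = solve-∀ ℚ-ring

module _ (D : CycleData 2) (pos : CycleData.Positive D firstNegative) where
  open CycleData D

  private
    v₁ v₂ : Fin 3
    v₁ = suc zero
    v₂ = suc (suc zero)

  -- Up to rotation, the triangles with weights 1, 3, 3 allowed by ∏α≡∏β; (1, 1, β 1) is a null vector.
  triangle-test : α zero ≡ 1 → β zero ≡ 1 → α v₁ ℕ.* β v₁ ≡ 3 → α v₂ ≡ β v₁ → ⊥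
  triangle-test a₀ b₀ w₁ a₂ = ℚP.<-irrefl (sym value) (pos μ (zero , λ ()))
    where
    d₀ = d zero
    d₁ = d v₁
    d₂ = d v₂
    U = ⟦ β v₁ ⟧
    μ : Fin 3 → ℚ
    μ zero = 1ℚ
    μ (suc zero) = 1ℚ
    μ (suc (suc zero)) = U
    expand : ∀ d₀ d₁ d₂ c₀ c₁ c₂ U →
      d₀ * (1ℚ * 1ℚ) - - 1ℚ * c₀ * (1ℚ * 1ℚ) + (d₁ * (1ℚ * 1ℚ) - 1ℚ * c₁ * (1ℚ * U)
        + (d₂ * (U * U) - 1ℚ * c₂ * (U * 1ℚ) + 0ℚ))
      ≡ d₀ + c₀ + d₁ - c₁ * U + (d₂ * U * U - c₂ * U)
    expand = solve-∀ ℚ-ring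
    d₀≡d₁ : d₀ ≡ d₁
    d₀≡d₁ = trans (sym (ℚP.*-identityʳ d₀)) (trans (sym (c-at D a₀)) (trans (balanced zero) (trans (cong (λ b → d₁ * ⟦ b ⟧) b₀) (ℚP.*-identityʳ d₁))))
    c₁U≡3d₁ : c v₁ * U ≡ d₁ * ⟦ 3 ⟧
    c₁U≡3d₁ = trans (ℚP.*-assoc d₁ ⟦ α v₁ ⟧ U) (cong (d₁ *_) (trans (sym (⟦⟧-homo-* (α v₁) (β v₁))) (cong ⟦_⟧ w₁)))
    value : form firstNegative μ ≡ 0ℚ
    value = begin
      form firstNegative μ
        ≡⟨ expand d₀ d₁ d₂ (c zero) (c v₁) (c v₂) U ⟩
      d₀ + c zero + d₁ - c v₁ * U + (d₂ * U * U - c v₂ * U)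
        ≡⟨ cong₂ (λ x y → d₀ + x + d₁ - c v₁ * U + (d₂ * U * U - y * U)) (trans (c-at D a₀) (ℚP.*-identityʳ d₀)) (c-at D a₂) ⟩
      d₀ + d₀ + d₁ - c v₁ * U + (d₂ * U * U - d₂ * U * U)
        ≡⟨ cong (λ x → d₀ + d₀ + d₁ - x + (d₂ * U * U - d₂ * U * U)) c₁U≡3d₁ ⟩
      d₀ + d₀ + d₁ - d₁ * ⟦ 3 ⟧ + (d₂ * U * U - d₂ * U * U)
        ≡⟨ simplify d₀ d₁ (d₂ * U * U) ⟩
      ⟦ 2 ⟧ * (d₀ - d₁)
        ≡⟨ cong (λ x → ⟦ 2 ⟧ * (x - d₁)) d₀≡d₁ ⟩
      ⟦ 2 ⟧ * (d₁ - d₁)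
        ≡⟨ cong (⟦ 2 ⟧ *_) (ℚP.+-inverseʳ d₁) ⟩
      0ℚ ∎
      where
      open ≡-Reasoning
      simplify : ∀ x y z → x + x + y - y * ⟦ 3 ⟧ + (z - z) ≡ ⟦ 2 ⟧ * (x - y)
      simplify = solve-∀ ℚ-ring

weight<4 : ∀ {m} (D : CycleData (suc (suc m))) → CycleData.Positive D firstNegative →
           ∀ k → CycleData.weight D k ℕ.< 4
weight<4 D pos k = subst (λ v → CycleData.weight D v ℕ.< 4) (rotationTo-one k)
  (edge-test (rotateData ρ D) (Positive-rotate-firstNegative ρ D pos))
  where ρ = rotationTo (prev k)

adjacent-weights<4 : ∀ {m} (D : CycleData (suc (suc (suc m)))) → CycleData.Positive D firstNegative → ∀ k →
                     let open CycleData D in weight k ℕ.+ weight (next k) ℕ.< 4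
adjacent-weights<4 D pos k = subst (λ v → weight v ℕ.+ weight (next v) ℕ.< 4) (rotationTo-one k)
  (subst (λ v → weight (rot ρ (suc zero)) ℕ.+ weight v ℕ.< 4) (Rotation.perm-next ρ (suc zero))
    (path-test (rotateData ρ D) (Positive-rotate-firstNegative ρ D pos)))
  where
  open CycleData D
  ρ = rotationTo (prev k)

no-affine-path : ∀ {m} (D : CycleData (suc (suc (suc (suc m))))) → CycleData.Positive D firstNegative → ∀ k →
  let open CycleData D in
  α k ≡ 1 → β k ≡ 2 → α (next k) ≡ 1 → β (next k) ≡ 1 → α (next (next k)) ≡ 2 → β (next (next k)) ≡ 1 → ⊥
no-affine-path D pos k a₁ b₁ a₂ b₂ a₃ b₃ = affine-path-test (rotateData ρ D) (Positive-rotate-firstNegative ρ D pos)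
  (trans (cong α p₁) a₁) (trans (cong β p₁) b₁) (trans (cong α p₂) a₂) (trans (cong β p₂) b₂) (trans (cong α p₃) a₃) (trans (cong β p₃) b₃)
  where
  open CycleData D
  ρ = rotationTo (prev k)
  p₁ : rot ρ (suc zero) ≡ k
  p₁ = rotationTo-one k
  p₂ : rot ρ (suc (suc zero)) ≡ next k
  p₂ = trans (Rotation.perm-next ρ (suc zero)) (cong next p₁)
  p₃ : rot ρ (suc (suc (suc zero))) ≡ next (next k)
  p₃ = trans (Rotation.perm-next ρ (suc (suc zero))) (cong next p₂)

deletion-bound : ∀ {m} (D : CycleData (suc m)) → CycleData.Positive D firstNegative →
  let open CycleData D in
  ∀ y u → u ≢ y → u ≢ next y → 2 ℕ.≤ α u → d u < d y
deletion-bound {m} D pos y u u≢y u≢ny 2≤αu =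
  subst₂ (λ a b → d a < d b) (Rotation.rot-unrot ρ u) at-last
    (deletion-test (rotateData ρ D) (Positive-rotate-firstNegative ρ D pos) (unrot ρ u) u′≢0 u′≢last
      (subst (2 ℕ.≤_) (cong α (sym (Rotation.rot-unrot ρ u))) 2≤αu))
  where
  open CycleData D
  ρ = rotationTo (next y)
  at-last : rot ρ (fromℕ (suc m)) ≡ y
  at-last = trans (Rotation.rot-prev ρ zero) (trans (cong prev (rotationTo-zero (next y))) (prev-next y))
  u′≢0 : unrot ρ u ≢ zero
  u′≢0 eq = u≢ny (trans (sym (Rotation.rot-unrot ρ u)) (trans (cong (rot ρ) eq) (rotationTo-zero (next y))))
  u′≢last : unrot ρ u ≢ fromℕ (suc m)
  u′≢last eq = u≢y (trans (sym (Rotation.rot-unrot ρ u)) (trans (cong (rot ρ) eq) at-last))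

no-degenerate-triangle : ∀ (D : CycleData 2) → CycleData.Positive D firstNegative → ∀ k →
  let open CycleData D in
  α k ≡ 1 → β k ≡ 1 → α (next k) ℕ.* β (next k) ≡ 3 → α (next (next k)) ≡ β (next k) → ⊥
no-degenerate-triangle D pos k a₀ b₀ w₁ a₂ = triangle-test (rotateData ρ D) (Positive-rotate-firstNegative ρ D pos)
  (trans (cong α p₀) a₀) (trans (cong β p₀) b₀) (trans (cong weight p₁) w₁) (trans (cong α p₂) (trans a₂ (cong β (sym p₁))))
  where
  open CycleData D
  ρ = rotationTo k
  p₀ : rot ρ zero ≡ k
  p₀ = rotationTo-zero k
  p₁ : rot ρ (suc zero) ≡ next k
  p₁ = trans (Rotation.perm-next ρ zero) (cong next p₀)
  p₂ : rot ρ (suc (suc zero)) ≡ next (next k)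
  p₂ = trans (Rotation.perm-next ρ (suc zero)) (cong next p₁)

-- Classification

listed? : ∀ {m} (w : Fin (suc m) → ℕ) → Dec (OfListedType w)
listed? {m} w = FP.all? (λ k → w k ℕ.≟ 1)
  ⊎-dec ((m ℕ.≟ 2) ×-dec FP.any? (λ k → (w k ℕ.≟ 1) ×-dec FP.all? (λ j → ¬? (j F.≟ k) →-dec (w j ℕ.≟ 2)))
  ⊎-dec ((m ℕ.≟ 3) ×-dec FP.any? (λ k → (w k ℕ.≟ 2) ×-dec (w (next k) ℕ.≟ 1) ×-dec (w (next (next k)) ℕ.≟ 2)
                                        ×-dec (w (next (next (next k))) ℕ.≟ 1))))

listed-cong : ∀ {m} {f g : Fin (suc m) → ℕ} → (∀ k → f k ≡ g k) → OfListedType f → OfListedType g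
listed-cong f≗g (inj₁ ones) = inj₁ (λ k → trans (sym (f≗g k)) (ones k))
listed-cong f≗g (inj₂ (inj₁ (m≡2 , k , fk≡1 , twos))) =
  inj₂ (inj₁ (m≡2 , k , trans (sym (f≗g k)) fk≡1 , λ j j≢k → trans (sym (f≗g j)) (twos j j≢k)))
listed-cong f≗g (inj₂ (inj₂ (m≡3 , k , w₀ , w₁ , w₂ , w₃))) =
  inj₂ (inj₂ (m≡3 , k , trans (sym (f≗g _)) w₀ , trans (sym (f≗g _)) w₁ , trans (sym (f≗g _)) w₂ , trans (sym (f≗g _)) w₃))

shapes≤3 : List (ℕ × ℕ)
shapes≤3 = (1 , 1) ∷ (1 , 2) ∷ (2 , 1) ∷ (1 , 3) ∷ (3 , 1) ∷ []

shape∈shapes≤3 : ∀ {a b} → 1 ℕ.≤ a → 1 ℕ.≤ b → a ℕ.* b ℕ.< 4 → (a , b) ∈ shapes≤3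
shape∈shapes≤3 {a} {b} 1≤a 1≤b ab<4 = bounded a b 1≤a 1≤b (bound (ℕP.m≤m*n a b)) (bound (ℕP.m≤n*m b a)) ab<4
  where
  instance
    _ = ℕ.>-nonZero 1≤a
    _ = ℕ.>-nonZero 1≤b
  bound : ∀ {x} → x ℕ.≤ a ℕ.* b → x ℕ.≤ 3
  bound x≤ab = ℕP.≤-pred (ℕP.≤-trans (s≤s x≤ab) ab<4)
  bounded : ∀ a b → 1 ℕ.≤ a → 1 ℕ.≤ b → a ℕ.≤ 3 → b ℕ.≤ 3 → a ℕ.* b ℕ.< 4 → (a , b) ∈ shapes≤3
  bounded 1 1 _ _ _ _ _ = here refl
  bounded 1 2 _ _ _ _ _ = there (here refl)
  bounded 2 1 _ _ _ _ _ = there (there (here refl))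
  bounded 1 3 _ _ _ _ _ = there (there (there (here refl)))
  bounded 3 1 _ _ _ _ _ = there (there (there (there (here refl))))
  bounded 2 2 _ _ _ _ (s≤s (s≤s (s≤s (s≤s ()))))
  bounded 2 3 _ _ _ _ (s≤s (s≤s (s≤s (s≤s ()))))
  bounded 3 2 _ _ _ _ (s≤s (s≤s (s≤s (s≤s ()))))
  bounded 3 3 _ _ _ _ (s≤s (s≤s (s≤s (s≤s ()))))
  bounded (suc (suc (suc (suc _)))) _ _ _ (s≤s (s≤s (s≤s ()))) _ _
  bounded _ (suc (suc (suc (suc _)))) _ _ _ (s≤s (s≤s (s≤s ()))) _

module _ (p₀ p₁ p₂ : ℕ × ℕ) where

  private
    α′ β′ : Fin 3 → ℕ
    α′ = Vec.lookup (proj₁ p₀ Vec.∷ proj₁ p₁ Vec.∷ proj₁ p₂ Vec.∷ Vec.[])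
    β′ = Vec.lookup (proj₂ p₀ Vec.∷ proj₂ p₁ Vec.∷ proj₂ p₂ Vec.∷ Vec.[])

  TriangleClaim : Set
  TriangleClaim = ∏ℕ α′ ≡ ∏ℕ β′ →
    (∀ k → ¬ (α′ k ≡ 1 × β′ k ≡ 1 × α′ (next k) ℕ.* β′ (next k) ≡ 3 × α′ (next (next k)) ≡ β′ (next k))) →
    OfListedType (λ k → α′ k ℕ.* β′ k)

  triangleClaim? : Dec TriangleClaim
  triangleClaim? = (∏ℕ α′ ℕ.≟ ∏ℕ β′) →-dec
    (FP.all? (λ k → ¬? ((α′ k ℕ.≟ 1) ×-dec (β′ k ℕ.≟ 1) ×-dec (α′ (next k) ℕ.* β′ (next k) ℕ.≟ 3) ×-dec (α′ (next (next k)) ℕ.≟ β′ (next k))))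
      →-dec listed? (λ k → α′ k ℕ.* β′ k))

triangle-claims : All.All (λ p₀ → All.All (λ p₁ → All.All (λ p₂ → TriangleClaim p₀ p₁ p₂) shapes≤3) shapes≤3) shapes≤3
triangle-claims = from-yes (All.all? (λ p₀ → All.all? (λ p₁ → All.all? (λ p₂ → triangleClaim? p₀ p₁ p₂) shapes≤3) shapes≤3) shapes≤3)

classify-triangle : (D : CycleData 2) → CycleData.Positive D firstNegative → OfListedType (CycleData.weight D)
classify-triangle D pos = listed-cong same-weights (claim (∏α≡∏β D) λ
  { zero             (a₀ , b₀ , w₁ , a₂) → no-degenerate-triangle D pos zero a₀ b₀ w₁ a₂
  ; (suc zero)       (a₀ , b₀ , w₁ , a₂) → no-degenerate-triangle D pos (suc zero) a₀ b₀ w₁ a₂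
  ; (suc (suc zero)) (a₀ , b₀ , w₁ , a₂) → no-degenerate-triangle D pos (suc (suc zero)) a₀ b₀ w₁ a₂
  })
  where
  open CycleData D
  shape : ∀ k → (α k , β k) ∈ shapes≤3
  shape k = shape∈shapes≤3 (α-pos k) (β-pos k) (weight<4 D pos k)
  claim = All.lookup (All.lookup (All.lookup triangle-claims (shape zero)) (shape (suc zero))) (shape (suc (suc zero)))
  same-weights : ∀ k → _ ≡ weight k
  same-weights zero = refl
  same-weights (suc zero) = refl
  same-weights (suc (suc zero)) = refl

data Shape≤2 (a b : ℕ) : Set where
  one-one : a ≡ 1 → b ≡ 1 → Shape≤2 a b
  one-two : a ≡ 1 → b ≡ 2 → Shape≤2 a b
  two-one : a ≡ 2 → b ≡ 1 → Shape≤2 a b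

shape≤2 : ∀ {a b} → 1 ℕ.≤ a → 1 ℕ.≤ b → a ℕ.* b ℕ.≤ 2 → Shape≤2 a b
shape≤2 1≤a 1≤b ab≤2 with shape∈shapes≤3 1≤a 1≤b (s≤s (ℕP.≤-trans ab≤2 (ℕP.n≤1+n 2)))
... | here refl                                = one-one refl refl
... | there (here refl)                        = one-two refl refl
... | there (there (here refl))                = two-one refl refl
... | there (there (there (here refl)))        = contradiction ab≤2 λ { (s≤s (s≤s ())) }
... | there (there (there (there (here refl)))) = contradiction ab≤2 λ { (s≤s (s≤s ())) }

shapes≤2 : List (ℕ × ℕ)
shapes≤2 = (1 , 1) ∷ (1 , 2) ∷ (2 , 1) ∷ []

shape≤2∈ : ∀ {a b} → Shape≤2 a b → (a , b) ∈ shapes≤2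
shape≤2∈ (one-one refl refl) = here refl
shape≤2∈ (one-two refl refl) = there (here refl)
shape≤2∈ (two-one refl refl) = there (there (here refl))

weight≤2 : ∀ {m} (D : CycleData (suc (suc (suc m)))) → CycleData.Positive D firstNegative → ∀ k → CycleData.weight D k ℕ.≤ 2
weight≤2 D pos k = ℕP.+-cancelʳ-≤ 1 (weight k) 2
  (ℕP.≤-trans (ℕP.+-monoʳ-≤ (weight k) (ℕP.*-mono-≤ (α-pos (next k)) (β-pos (next k)))) (ℕP.≤-pred (adjacent-weights<4 D pos k)))
  where open CycleData D

module _ (p₀ p₁ p₂ p₃ : ℕ × ℕ) where

  private
    α′ β′ w′ : Fin 4 → ℕ
    α′ = Vec.lookup (proj₁ p₀ Vec.∷ proj₁ p₁ Vec.∷ proj₁ p₂ Vec.∷ proj₁ p₃ Vec.∷ Vec.[])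
    β′ = Vec.lookup (proj₂ p₀ Vec.∷ proj₂ p₁ Vec.∷ proj₂ p₂ Vec.∷ proj₂ p₃ Vec.∷ Vec.[])
    w′ k = α′ k ℕ.* β′ k

  SquareClaim : Set
  SquareClaim = ∏ℕ α′ ≡ ∏ℕ β′ → (∀ k → w′ k ℕ.+ w′ (next k) ℕ.< 4) → OfListedType w′

  squareClaim? : Dec SquareClaim
  squareClaim? = (∏ℕ α′ ℕ.≟ ∏ℕ β′) →-dec (FP.all? (λ k → w′ k ℕ.+ w′ (next k) ℕP.<? 4) →-dec listed? w′)

square-claims : All.All (λ p₀ → All.All (λ p₁ → All.All (λ p₂ → All.All (λ p₃ → SquareClaim p₀ p₁ p₂ p₃)
                  shapes≤2) shapes≤2) shapes≤2) shapes≤2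
square-claims = from-yes (All.all? (λ p₀ → All.all? (λ p₁ → All.all? (λ p₂ → All.all? (λ p₃ → squareClaim? p₀ p₁ p₂ p₃)
                  shapes≤2) shapes≤2) shapes≤2) shapes≤2)

classify-square : (D : CycleData 3) → CycleData.Positive D firstNegative → OfListedType (CycleData.weight D)
classify-square D pos = listed-cong same-weights (claim (∏α≡∏β D) λ
  { zero                   → adjacent-weights<4 D pos zero
  ; (suc zero)             → adjacent-weights<4 D pos (suc zero)
  ; (suc (suc zero))       → adjacent-weights<4 D pos (suc (suc zero))
  ; (suc (suc (suc zero))) → adjacent-weights<4 D pos (suc (suc (suc zero)))
  })
  where
  open CycleData D
  shape : ∀ k → (α k , β k) ∈ shapes≤2
  shape k = shape≤2∈ (shape≤2 (α-pos k) (β-pos k) (weight≤2 D pos k))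
  claim = All.lookup (All.lookup (All.lookup (All.lookup square-claims (shape zero)) (shape (suc zero)))
                       (shape (suc (suc zero)))) (shape (suc (suc (suc zero))))
  same-weights : ∀ k → _ ≡ weight k
  same-weights zero = refl
  same-weights (suc zero) = refl
  same-weights (suc (suc zero)) = refl
  same-weights (suc (suc (suc zero))) = refl

∏ℕ≡1 : ∀ {n} {f : Fin n → ℕ} → ∏ℕ f ≡ 1 → ∀ i → f i ≡ 1
∏ℕ≡1 {suc n} {f} eq zero    = ℕP.m*n≡1⇒m≡1 (f zero) (∏ℕ (f ∘ suc)) eq
∏ℕ≡1 {suc n} {f} eq (suc i) = ∏ℕ≡1 (ℕP.m*n≡1⇒n≡1 (f zero) (∏ℕ (f ∘ suc)) eq) i

argmin-exists : ∀ {n} (f : Fin (suc n) → ℚ) → ∃ λ y → ∀ i → f y ≤ f i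
argmin-exists {n} f = argmin f zero (allFin (suc n)) , λ i → All.lookup (f[argmin]≤f[xs] {f = f} zero (allFin (suc n))) (∈-allFin i)

module _ {m : ℕ} (D : CycleData (suc (suc (suc (suc m))))) (pos : CycleData.Positive D firstNegative) where
  open CycleData D

  private
    2≤m : 2 ℕ.≤ suc (suc (suc (suc m)))
    2≤m = s≤s (s≤s z≤n)

    weight-pos : ∀ k → 1 ℕ.≤ weight k
    weight-pos k = ℕP.*-mono-≤ (α-pos k) (β-pos k)

    shape : ∀ k → Shape≤2 (α k) (β k)
    shape k = shape≤2 (α-pos k) (β-pos k) (weight≤2 D pos k)

    flat-balanced : ∀ {k} → α k ≡ 1 → β k ≡ 1 → d k ≡ d (next k)
    flat-balanced {k} a b = trans (sym (ℚP.*-identityʳ (d k))) (trans (sym (c-at D a))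
      (trans (balanced k) (trans (cong (λ x → d (next k) * ⟦ x ⟧) b) (ℚP.*-identityʳ (d (next k))))))

    descent-shape : ∀ {u} → α u ≡ 2 → β u ≡ 1
    descent-shape {u} αu≡2 = from-shape (shape u)
      where
      from-shape : Shape≤2 (α u) (β u) → β u ≡ 1
      from-shape (one-one a _) = contradiction (trans (sym a) αu≡2) λ ()
      from-shape (one-two a _) = contradiction (trans (sym a) αu≡2) λ ()
      from-shape (two-one _ b) = b

    before-descent : ∀ {u} → α u ≡ 2 → α (prev u) ≡ 1 × β (prev u) ≡ 1
    before-descent {u} αu≡2 = ℕP.m*n≡1⇒m≡1 (α (prev u)) (β (prev u)) light , ℕP.m*n≡1⇒n≡1 (α (prev u)) (β (prev u)) light
      where
      light : weight (prev u) ≡ 1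
      light = ℕP.≤-antisym
        (ℕP.+-cancelʳ-≤ 2 (weight (prev u)) 1
          (subst (λ w → weight (prev u) ℕ.+ w ℕ.≤ 3) (trans (cong weight (next-prev u)) (cong₂ ℕ._*_ αu≡2 (descent-shape αu≡2)))
                 (ℕP.≤-pred (adjacent-weights<4 D pos (prev u)))))
        (weight-pos (prev u))

    before-descent-balanced : ∀ {u} → α u ≡ 2 → d (prev u) ≡ d u
    before-descent-balanced {u} αu≡2 =
      trans (flat-balanced (proj₁ (before-descent αu≡2)) (proj₂ (before-descent αu≡2))) (cong d (next-prev u))

  -- With p = prev u and z = prev p, the three possible edges z are excluded by the deletion
  -- test at z, the deletion test at p, and the affine path z, p, u.
  no-descent-after-minimum : ∀ u → α u ≡ 2 → (∀ i → d (prev u) ≤ d i) → ⊥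
  no-descent-after-minimum u αu≡2 minimal = excluded (shape z)
    where
    p = prev u
    z = prev p
    np : next p ≡ u
    np = next-prev u
    nz : next z ≡ p
    nz = next-prev p
    nnz : next (next z) ≡ u
    nnz = trans (cong next nz) np
    dp≡du : d p ≡ d u
    dp≡du = before-descent-balanced αu≡2
    u≢z : u ≢ z
    u≢z u≡z = next²≢id 2≤m z (trans nnz u≡z)
    u≢p : u ≢ p
    u≢p u≡p = next≢id (s≤s z≤n) p (trans np u≡p)
    excluded : Shape≤2 (α z) (β z) → ⊥
    excluded (one-one a b) = <⇒≱ (deletion-bound D pos z u u≢z (λ u≡nz → u≢p (trans u≡nz nz)) (ℕP.≤-reflexive (sym αu≡2)))
      (ℚP.≤-reflexive (trans (trans (flat-balanced a b) (cong d nz)) dp≡du))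
    excluded (two-one a _) = <⇒≱ (deletion-bound D pos p z (λ z≡p → next≢id (s≤s z≤n) z (trans nz (sym z≡p)))
                                                         (λ z≡np → u≢z (trans (sym np) (sym z≡np))) (ℕP.≤-reflexive (sym a)))
      (minimal z)
    excluded (one-two a b) = no-affine-path D pos z a b
      (trans (cong α nz) (proj₁ (before-descent αu≡2))) (trans (cong β nz) (proj₂ (before-descent αu≡2)))
      (trans (cong α nnz) αu≡2) (trans (cong β nnz) (descent-shape αu≡2))

  some-descent : ∀ e → weight e ≡ 2 → ∃ λ u → α u ≡ 2
  some-descent e we≡2 = decided (FP.any? (λ u → α u ℕ.≟ 2))
    where
    flat : ∀ {i} → Shape≤2 (α i) (β i) → α i ≢ 2 → α i ≡ 1
    flat (one-one a _) _    = a
    flat (one-two a _) _    = a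
    flat (two-one a _) α≢2 = contradiction a α≢2
    decided : Dec (∃ λ u → α u ≡ 2) → ∃ λ u → α u ≡ 2
    decided (yes found) = found
    decided (no none)   = contradiction (trans (sym we≡2) (cong₂ ℕ._*_ (all-flat e) (∏ℕ≡1 {f = β} ∏β≡1 e))) λ ()
      where
      all-flat : ∀ i → α i ≡ 1
      all-flat i = flat (shape i) (λ a → none (i , a))
      ∏β≡1 : ∏ℕ β ≡ 1
      ∏β≡1 = trans (sym (∏α≡∏β D)) (trans (∏ℕ-cong-≗ {x = α} {y = λ _ → 1} all-flat) (∏ℕ-replicate-one (suc (suc (suc (suc (suc m)))))))

  -- Take u with α u = 2 and y minimizing d: the deletion test at y forces u ∈ {y, next y}.
  no-descent : (∃ λ u → α u ≡ 2) → (∃ λ y → ∀ i → d y ≤ d i) → ⊥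
  no-descent (u , αu≡2) (y , y-min) = located (u F.≟ y) (u F.≟ next y)
    where
    located : Dec (u ≡ y) → Dec (u ≡ next y) → ⊥
    located (yes refl) _ = no-descent-after-minimum u αu≡2 (λ i → subst (_≤ d i) (sym (before-descent-balanced αu≡2)) (y-min i))
    located (no _) (yes refl) = no-descent-after-minimum u αu≡2 (λ i → subst (_≤ d i) (cong d (sym (prev-next y))) (y-min i))
    located (no u≢y) (no u≢ny) = contradiction (y-min u) (<⇒≱ (deletion-bound D pos y u u≢y u≢ny (ℕP.≤-reflexive (sym αu≡2))))

  all-weights-one : ∀ k → weight k ≡ 1
  all-weights-one k = decided (weight k ℕ.≟ 2)
    where
    decided : Dec (weight k ≡ 2) → weight k ≡ 1
    decided (no wk≢2)  = ℕP.≤-antisym (ℕP.≤-pred (ℕP.≤∧≢⇒< (weight≤2 D pos k) wk≢2)) (weight-pos k)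
    decided (yes wk≡2) = ⊥-elim (no-descent (some-descent k wk≡2) (argmin-exists d))

classify : ∀ {m} → 2 ℕ.≤ m → (D : CycleData m) → CycleData.Positive D firstNegative → OfListedType (CycleData.weight D)
classify {2}                       _ = classify-triangle
classify {3}                       _ = classify-square
classify {suc (suc (suc (suc m)))} _ D pos = inj₁ (all-weights-one D pos)
classify {suc zero} (s≤s ())

-- The listed cycles are positive

squares-positive : ∀ {k n} (r : Fin (suc k) → ℚ) {μ : Fin n → ℚ} →
                   ((∀ j → r j ≡ 0ℚ) → ∀ i → μ i ≡ 0ℚ) → Nonzero μ → 0ℚ < sum (λ j → r j * r j)
squares-positive {k} r r≡0⇒μ≡0 (i , μi≢0) = decided (FP.all? (λ j → r j ℚP.≟ 0ℚ))
  where
  decided : Dec (∀ j → r j ≡ 0ℚ) → 0ℚ < sum (λ j → r j * r j)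
  decided (yes r≡0) = contradiction (r≡0⇒μ≡0 r≡0 i) μi≢0
  decided (no r≢0) with FP.¬∀⟶∃¬ (suc k) (λ j → r j ≡ 0ℚ) (λ j → r j ℚP.≟ 0ℚ) r≢0
  ... | j , rj≢0 = ℚP.<-≤-trans (square-pos rj≢0) (sum-≥-term (λ j → square-nonneg (r j)) j)

+-cancelʳ-≡ : ∀ {x y} z → x + z ≡ y + z → x ≡ y
+-cancelʳ-≡ {x} {y} z eq = trans (shift x z) (trans (cong (_- z) eq) (sym (shift y z)))
  where
  shift : ∀ a b → a ≡ a + b - b
  shift = solve-∀ ℚ-ring

double-zero : ∀ {x} → ⟦ 2 ⟧ * x ≡ 0ℚ → x ≡ 0ℚ
double-zero {x} eq = *-cancelˡ-≡-pos (⟦⟧-pos {2} (s≤s z≤n)) (trans eq (sym (ℚP.*-zeroʳ ⟦ 2 ⟧)))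

uniform : ∀ {m} → CycleData m
uniform = record
  { d = λ _ → 1ℚ ; α = λ _ → 1 ; β = λ _ → 1
  ; d-pos = λ _ → ℚP.positive⁻¹ 1ℚ ; α-pos = λ _ → s≤s z≤n ; β-pos = λ _ → s≤s z≤n
  ; balanced = λ _ → refl
  }

module _ {m : ℕ} where
  open CycleData (uniform {suc m})

  private
    residual : (Fin (suc (suc m)) → Sign) → (Fin (suc (suc m)) → ℚ) → Fin (suc (suc m)) → ℚ
    residual g μ i = μ i - σ (g i) * μ (next i)

    uniform-squares : ∀ g μ → sum (λ i → residual g μ i * residual g μ i) ≡ ⟦ 2 ⟧ * form g μ
    uniform-squares g μ = +-cancelʳ-≡ (sum (λ i → μ i * μ i)) (begin
      sum (λ i → residual g μ i * residual g μ i) + sum (λ i → μ i * μ i)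
        ≡⟨ ∑-distrib-+ (λ i → residual g μ i * residual g μ i) (λ i → μ i * μ i) ⟨
      sum (λ i → residual g μ i * residual g μ i + μ i * μ i)
        ≡⟨ sum-cong-≗ (λ i → trans (expand (μ i) (μ (next i)) (σ (g i))) (cong (λ s → ⟦ 2 ⟧ * edgeTerm g μ i + s * (μ (next i) * μ (next i))) (σ-square (g i)))) ⟩
      sum (λ i → ⟦ 2 ⟧ * edgeTerm g μ i + 1ℚ * (μ (next i) * μ (next i)))
        ≡⟨ ∑-distrib-+ (λ i → ⟦ 2 ⟧ * edgeTerm g μ i) (λ i → 1ℚ * (μ (next i) * μ (next i))) ⟩
      sum (λ i → ⟦ 2 ⟧ * edgeTerm g μ i) + sum (λ i → 1ℚ * (μ (next i) * μ (next i)))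
        ≡⟨ cong₂ _+_ (sym (*-distribˡ-sum ⟦ 2 ⟧ (edgeTerm g μ)))
                     (trans (sum-cong-≗ (λ i → ℚP.*-identityˡ (μ (next i) * μ (next i)))) (sym (sum-permute (λ i → μ i * μ i) nextPerm))) ⟩
      ⟦ 2 ⟧ * form g μ + sum (λ i → μ i * μ i) ∎)
      where
      open ≡-Reasoning
      expand : ∀ x y s → (x - s * y) * (x - s * y) + x * x ≡ ⟦ 2 ⟧ * (1ℚ * (x * x) - s * (1ℚ * ⟦ 1 ⟧) * (x * y)) + s * s * (y * y)
      expand = solve-∀ ℚ-ring

    -- Vanishing residuals give μ i ≡ - μ zero for i ≢ zero, and closing the cycle gives μ zero ≡ 0.
    residuals-vanish : ∀ μ → (∀ i → residual firstNegative μ i ≡ 0ℚ) → ∀ i → μ i ≡ 0ℚ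
    residuals-vanish μ r≡0 = vanish ∘ cycle-induction P (inj₁ refl) step
      where
      P : Fin (suc (suc m)) → Set
      P i = i ≡ zero ⊎ μ i ≡ - μ zero
      negated : ∀ {a b} → a - - 1ℚ * b ≡ 0ℚ → b ≡ - a
      negated {a} {b} eq = trans (solve-neg a b) (trans (cong (- a +_) eq) (ℚP.+-identityʳ (- a)))
        where solve-neg : ∀ a b → b ≡ - a + (a - - 1ℚ * b)
              solve-neg = solve-∀ ℚ-ring
      copied : ∀ {a b} → a - 1ℚ * b ≡ 0ℚ → b ≡ a
      copied {a} {b} eq = trans (solve-copy a b) (trans (cong (λ x → a - x) eq) (ℚP.+-identityʳ a))
        where solve-copy : ∀ a b → b ≡ a - (a - 1ℚ * b)
              solve-copy = solve-∀ ℚ-ring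
      step : ∀ i → P i → P (next i)
      step zero    _              = inj₂ (negated (r≡0 zero))
      step (suc j) (inj₂ μj≡-μ₀) = inj₂ (trans (copied (r≡0 (suc j))) μj≡-μ₀)
      μ₀≡0 : P (fromℕ (suc m)) → μ zero ≡ 0ℚ
      μ₀≡0 (inj₂ μlast≡-μ₀) = double-zero (trans (twice (μ zero)) (trans (cong (μ zero +_) self-negating) (ℚP.+-inverseʳ (μ zero))))
        where
        twice : ∀ x → ⟦ 2 ⟧ * x ≡ x + x
        twice = solve-∀ ℚ-ring
        self-negating : μ zero ≡ - μ zero
        self-negating = trans (cong μ (sym next-fromℕ)) (trans (copied (r≡0 (fromℕ (suc m)))) μlast≡-μ₀)
      vanish : ∀ {i} → P i → μ i ≡ 0ℚ
      vanish (inj₁ refl)     = μ₀≡0 (cycle-induction P (inj₁ refl) step (fromℕ (suc m)))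
      vanish (inj₂ μi≡-μ₀)  = trans μi≡-μ₀ (cong -_ (μ₀≡0 (cycle-induction P (inj₁ refl) step (fromℕ (suc m)))))

  uniform-positive : Positive firstNegative
  uniform-positive μ μ≢0 = *-cancelˡ-pos (⟦⟧-pos {2} (s≤s z≤n))
    (subst (0ℚ <_) (uniform-squares firstNegative μ) (squares-positive (residual firstNegative μ) (residuals-vanish μ) μ≢0))

triangle₁₂₂ : CycleData 2
triangle₁₂₂ = record
  { d = λ { zero → 1ℚ ; (suc zero) → 1ℚ ; (suc (suc zero)) → ⟦ 2 ⟧ }
  ; α = λ { zero → 1 ; (suc zero) → 2 ; (suc (suc zero)) → 1 }
  ; β = λ { zero → 1 ; (suc zero) → 1 ; (suc (suc zero)) → 2 }
  ; d-pos = λ { zero → ℚP.positive⁻¹ 1ℚ ; (suc zero) → ℚP.positive⁻¹ 1ℚ ; (suc (suc zero)) → ⟦⟧-pos {2} (s≤s z≤n) }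
  ; α-pos = λ { zero → s≤s z≤n ; (suc zero) → s≤s z≤n ; (suc (suc zero)) → s≤s z≤n }
  ; β-pos = λ { zero → s≤s z≤n ; (suc zero) → s≤s z≤n ; (suc (suc zero)) → s≤s z≤n }
  ; balanced = λ { zero → refl ; (suc zero) → refl ; (suc (suc zero)) → refl }
  }

triangle₁₂₂-positive : CycleData.Positive triangle₁₂₂ firstNegative
triangle₁₂₂-positive μ μ≢0 = *-cancelˡ-pos (⟦⟧-pos {2} (s≤s z≤n)) (subst (0ℚ <_) (sym (squares (μ zero) (μ (suc zero)) (μ (suc (suc zero)))))
  (squares-positive r r≡0⇒μ≡0 μ≢0))
  where
  squares : ∀ y₀ y₁ y₂ →
    ⟦ 2 ⟧ * (1ℚ * (y₀ * y₀) - - 1ℚ * (1ℚ * ⟦ 1 ⟧) * (y₀ * y₁) + (1ℚ * (y₁ * y₁) - 1ℚ * (1ℚ * ⟦ 2 ⟧) * (y₁ * y₂)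
      + (⟦ 2 ⟧ * (y₂ * y₂) - 1ℚ * (⟦ 2 ⟧ * ⟦ 1 ⟧) * (y₂ * y₀) + 0ℚ)))
    ≡ (⟦ 2 ⟧ * y₂ - y₀ - y₁) * (⟦ 2 ⟧ * y₂ - y₀ - y₁) + (y₀ * y₀ + (y₁ * y₁ + 0ℚ))
  squares = solve-∀ ℚ-ring
  r : Fin 3 → ℚ
  r zero             = ⟦ 2 ⟧ * μ (suc (suc zero)) - μ zero - μ (suc zero)
  r (suc zero)       = μ zero
  r (suc (suc zero)) = μ (suc zero)
  r≡0⇒μ≡0 : (∀ j → r j ≡ 0ℚ) → ∀ i → μ i ≡ 0ℚ
  r≡0⇒μ≡0 r≡0 zero             = r≡0 (suc zero)
  r≡0⇒μ≡0 r≡0 (suc zero)       = r≡0 (suc (suc zero))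
  r≡0⇒μ≡0 r≡0 (suc (suc zero)) = double-zero (begin
    ⟦ 2 ⟧ * μ (suc (suc zero))        ≡⟨ recombine (μ zero) (μ (suc zero)) (μ (suc (suc zero))) ⟩
    r zero + r (suc zero) + r (suc (suc zero)) ≡⟨ cong₂ _+_ (cong₂ _+_ (r≡0 zero) (r≡0 (suc zero))) (r≡0 (suc (suc zero))) ⟩
    0ℚ                                ∎)
    where
    open ≡-Reasoning
    recombine : ∀ y₀ y₁ y₂ → ⟦ 2 ⟧ * y₂ ≡ (⟦ 2 ⟧ * y₂ - y₀ - y₁) + y₀ + y₁
    recombine = solve-∀ ℚ-ring

square₂₁₂₁ : CycleData 3
square₂₁₂₁ = record
  { d = λ { zero → 1ℚ ; (suc zero) → ⟦ 2 ⟧ ; (suc (suc zero)) → ⟦ 2 ⟧ ; (suc (suc (suc zero))) → 1ℚ }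
  ; α = λ { zero → 2 ; (suc zero) → 1 ; (suc (suc zero)) → 1 ; (suc (suc (suc zero))) → 1 }
  ; β = λ { zero → 1 ; (suc zero) → 1 ; (suc (suc zero)) → 2 ; (suc (suc (suc zero))) → 1 }
  ; d-pos = λ { zero → ℚP.positive⁻¹ 1ℚ ; (suc zero) → ⟦⟧-pos {2} (s≤s z≤n) ; (suc (suc zero)) → ⟦⟧-pos {2} (s≤s z≤n)
              ; (suc (suc (suc zero))) → ℚP.positive⁻¹ 1ℚ }
  ; α-pos = λ { zero → s≤s z≤n ; (suc zero) → s≤s z≤n ; (suc (suc zero)) → s≤s z≤n ; (suc (suc (suc zero))) → s≤s z≤n }
  ; β-pos = λ { zero → s≤s z≤n ; (suc zero) → s≤s z≤n ; (suc (suc zero)) → s≤s z≤n ; (suc (suc (suc zero))) → s≤s z≤n }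
  ; balanced = λ { zero → refl ; (suc zero) → refl ; (suc (suc zero)) → refl ; (suc (suc (suc zero))) → refl }
  }

square₂₁₂₁-positive : CycleData.Positive square₂₁₂₁ firstNegative
square₂₁₂₁-positive μ μ≢0 = *-cancelˡ-pos (⟦⟧-pos {4} (s≤s z≤n))
  (subst (0ℚ <_) (sym (squares (μ zero) (μ (suc zero)) (μ (suc (suc zero))) (μ (suc (suc (suc zero))))))
    (squares-positive r r≡0⇒μ≡0 μ≢0))
  where
  squares : ∀ y₀ y₁ y₂ y₃ →
    ⟦ 4 ⟧ * (1ℚ * (y₀ * y₀) - - 1ℚ * (1ℚ * ⟦ 2 ⟧) * (y₀ * y₁) + (⟦ 2 ⟧ * (y₁ * y₁) - 1ℚ * (⟦ 2 ⟧ * ⟦ 1 ⟧) * (y₁ * y₂)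
      + (⟦ 2 ⟧ * (y₂ * y₂) - 1ℚ * (⟦ 2 ⟧ * ⟦ 1 ⟧) * (y₂ * y₃) + (1ℚ * (y₃ * y₃) - 1ℚ * (1ℚ * ⟦ 1 ⟧) * (y₃ * y₀) + 0ℚ))))
    ≡ (⟦ 2 ⟧ * y₀ + ⟦ 2 ⟧ * y₁ - y₃) * (⟦ 2 ⟧ * y₀ + ⟦ 2 ⟧ * y₁ - y₃)
      + ((⟦ 2 ⟧ * y₁ - ⟦ 2 ⟧ * y₂ + y₃) * (⟦ 2 ⟧ * y₁ - ⟦ 2 ⟧ * y₂ + y₃)
      + ((⟦ 2 ⟧ * y₂ - y₃) * (⟦ 2 ⟧ * y₂ - y₃) + (y₃ * y₃ + 0ℚ)))
  squares = solve-∀ ℚ-ring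
  r : Fin 4 → ℚ
  r zero                   = ⟦ 2 ⟧ * μ zero + ⟦ 2 ⟧ * μ (suc zero) - μ (suc (suc (suc zero)))
  r (suc zero)             = ⟦ 2 ⟧ * μ (suc zero) - ⟦ 2 ⟧ * μ (suc (suc zero)) + μ (suc (suc (suc zero)))
  r (suc (suc zero))       = ⟦ 2 ⟧ * μ (suc (suc zero)) - μ (suc (suc (suc zero)))
  r (suc (suc (suc zero))) = μ (suc (suc (suc zero)))
  r≡0⇒μ≡0 : (∀ j → r j ≡ 0ℚ) → ∀ i → μ i ≡ 0ℚ
  r≡0⇒μ≡0 r≡0 zero = double-zero (trans (recombine₀ (μ zero) (μ (suc zero)) (μ (suc (suc zero))) (μ (suc (suc (suc zero)))))
    (cong₂ _+_ (cong₂ _-_ (cong₂ _-_ (r≡0 zero) (r≡0 (suc zero))) (r≡0 (suc (suc zero)))) (r≡0 (suc (suc (suc zero))))))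
    where
    recombine₀ : ∀ y₀ y₁ y₂ y₃ → ⟦ 2 ⟧ * y₀ ≡ (⟦ 2 ⟧ * y₀ + ⟦ 2 ⟧ * y₁ - y₃) - (⟦ 2 ⟧ * y₁ - ⟦ 2 ⟧ * y₂ + y₃) - (⟦ 2 ⟧ * y₂ - y₃) + y₃
    recombine₀ = solve-∀ ℚ-ring
  r≡0⇒μ≡0 r≡0 (suc zero) = double-zero (trans (recombine₁ (μ (suc zero)) (μ (suc (suc zero))) (μ (suc (suc (suc zero)))))
    (cong₂ _+_ (r≡0 (suc zero)) (r≡0 (suc (suc zero)))))
    where
    recombine₁ : ∀ y₁ y₂ y₃ → ⟦ 2 ⟧ * y₁ ≡ (⟦ 2 ⟧ * y₁ - ⟦ 2 ⟧ * y₂ + y₃) + (⟦ 2 ⟧ * y₂ - y₃)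
    recombine₁ = solve-∀ ℚ-ring
  r≡0⇒μ≡0 r≡0 (suc (suc zero)) = double-zero (trans (recombine₂ (μ (suc (suc zero))) (μ (suc (suc (suc zero)))))
    (cong₂ _+_ (r≡0 (suc (suc zero))) (r≡0 (suc (suc (suc zero))))))
    where
    recombine₂ : ∀ y₂ y₃ → ⟦ 2 ⟧ * y₂ ≡ (⟦ 2 ⟧ * y₂ - y₃) + y₃
    recombine₂ = solve-∀ ℚ-ring
  r≡0⇒μ≡0 r≡0 (suc (suc (suc zero))) = r≡0 (suc (suc (suc zero)))

module _ {m : ℕ} (ρ : Rotation m) (D : CycleData m) {w : Fin (suc m) → ℕ} where

  rotated-weights : (∀ j → CycleData.weight D j ≡ w (rot ρ j)) → ∀ i → CycleData.weight (rotateData (Rotation.inverse ρ) D) i ≡ w i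
  rotated-weights weights i = trans (weights (unrot ρ i)) (cong w (Rotation.rot-unrot ρ i))

listed-data : ∀ {m} → 2 ℕ.≤ m → (w : Fin (suc m) → ℕ) → OfListedType w →
              Σ (CycleData m) λ D → CycleData.Positive D firstNegative × (∀ i → CycleData.weight D i ≡ w i)
listed-data (s≤s _) w (inj₁ ones) = uniform , uniform-positive , λ i → sym (ones i)
listed-data _ w (inj₂ (inj₁ (refl , k , wk≡1 , twos))) =
  rotateData (Rotation.inverse ρ) triangle₁₂₂ ,
  Positive-rotate-firstNegative (Rotation.inverse ρ) triangle₁₂₂ triangle₁₂₂-positive ,
  rotated-weights ρ triangle₁₂₂ weights
  where
  ρ = rotationTo k
  off-k : ∀ j → rot ρ (suc j) ≢ k
  off-k j eq = FP.0≢1+n (sym (Rotation.rot-injective ρ (trans eq (sym (rotationTo-zero k)))))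
  weights : ∀ j → CycleData.weight triangle₁₂₂ j ≡ w (rot ρ j)
  weights zero             = sym (trans (cong w (rotationTo-zero k)) wk≡1)
  weights (suc zero)       = sym (twos _ (off-k zero))
  weights (suc (suc zero)) = sym (twos _ (off-k (suc zero)))
listed-data _ w (inj₂ (inj₂ (refl , k , w₀ , w₁ , w₂ , w₃))) =
  rotateData (Rotation.inverse ρ) square₂₁₂₁ ,
  Positive-rotate-firstNegative (Rotation.inverse ρ) square₂₁₂₁ square₂₁₂₁-positive ,
  rotated-weights ρ square₂₁₂₁ weights
  where
  ρ = rotationTo k
  p₀ : rot ρ zero ≡ k
  p₀ = rotationTo-zero k
  p₁ : rot ρ (suc zero) ≡ next k
  p₁ = trans (Rotation.perm-next ρ zero) (cong next p₀)
  p₂ : rot ρ (suc (suc zero)) ≡ next (next k)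
  p₂ = trans (Rotation.perm-next ρ (suc zero)) (cong next p₁)
  p₃ : rot ρ (suc (suc (suc zero))) ≡ next (next (next k))
  p₃ = trans (Rotation.perm-next ρ (suc (suc zero))) (cong next p₂)
  weights : ∀ j → CycleData.weight square₂₁₂₁ j ≡ w (rot ρ j)
  weights zero                   = sym (trans (cong w p₀) w₀)
  weights (suc zero)             = sym (trans (cong w p₁) w₁)
  weights (suc (suc zero))       = sym (trans (cong w p₂) w₂)
  weights (suc (suc (suc zero))) = sym (trans (cong w p₃) w₃)

realize : ∀ {m} → 2 ℕ.≤ m → (D : CycleData m) → CycleData.Positive D firstNegative →
          ∀ {w} → (∀ i → CycleData.weight D i ≡ w i) → ∀ ε → ∏± ε ≡ Sign.- → SignedPositive w ε
realize {m} 2≤m D pos weight≗w ε ∏ε≡- =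
  cycleMatrix 2≤m D ε ,
  (Realizes.diagonal R , CycleData.d D , realizes-symmetrizer 2≤m R , positive-realizes 2≤m R positive) ,
  (adjacency , (λ k → trans (weights k) (cong ℤ.+_ (weight≗w k))) , signs)
  where
  R = cycleMatrix-realizes 2≤m D ε
  positive : CycleData.Positive D ε
  positive = CycleData.Positive-gauge D firstNegative ε (trans (∏±-firstNegative {m}) (sym ∏ε≡-)) pos
  adjacency = proj₁ (realizes-diagram 2≤m R)
  weights = proj₁ (proj₂ (realizes-diagram 2≤m R))
  signs = proj₂ (proj₂ (realizes-diagram 2≤m R))

sufficient : ∀ {m} → 2 ℕ.≤ m → (w : Fin (suc m) → ℕ) → OfListedType w → ∀ ε → ∏± ε ≡ Sign.- → SignedPositive w ε
sufficient 2≤m w listed = let D , pos , weight≗w = listed-data 2≤m w listed in realize 2≤m D pos weight≗w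

necessary : ∀ {m} → 2 ℕ.≤ m → (w : Fin (suc m) → ℕ) → PositiveWeightedCycle w → OfListedType w
necessary {m} 2≤m w (ε , A , pq , dg) = listed-cong weight≗w (classify 2≤m cycleData positive₀)
  where
  open FromMatrix 2≤m pq dg
  positive₀ : CycleData.Positive cycleData firstNegative
  positive₀ = CycleData.Positive-gauge cycleData ε firstNegative
    (trans (CycleData.Positive⇒∏±≡- cycleData ε positive) (sym (∏±-firstNegative {m}))) positive

signProduct-negative : ∀ {m} → 2 ℕ.≤ m → ∀ {w ε} → SignedPositive {m} w ε → signProduct ε ≡ Sign.-
signProduct-negative 2≤m {ε = ε} (A , pq , dg) = trans (signProduct≡∏± ε) (CycleData.Positive⇒∏±≡- cycleData ε positive)
  where open FromMatrix 2≤m pq dg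

proposition2p6 :
    (m : ℕ) → 3 ℕ.≤ suc m →
    (w : Fin (suc m) → ℕ) → ((k : Fin (suc m)) → 1 ℕ.≤ w k) →
    (PositiveWeightedCycle w ⇔ OfListedType w)
    × (OfListedType w → (ε : Fin (suc m) → Sign) →
         (SignedPositive w ε ⇔ (signProduct ε ≡ Sign.-)))
-- The weights of a diagram are products of nonzero entries, so 1 ≤ w k is never needed.
proposition2p6 m 3≤n w _ =
  mk⇔ (necessary 2≤m w) (λ listed → firstNegative , sufficient 2≤m w listed firstNegative (∏±-firstNegative {m})) ,
  λ listed ε → mk⇔ (signProduct-negative 2≤m) (sufficient 2≤m w listed ε ∘ trans (sym (signProduct≡∏± ε)))
  where
  2≤m : 2 ℕ.≤ m
  2≤m = ℕP.≤-pred 3≤n
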